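{- Let $\eta=(\eta_1,\dots,\eta_r)$ be a composition of $n$. Then $$\sum_{\sigma\in S^{\eta}} x^{\operatorname{den}(\sigma)}\,y^{\operatorname{iexc}(\sigma)}=\sum_{w\in S_{\eta}} x^{\operatorname{den}_H(w)}\,y^{\operatorname{exc}(w)}.$$
   Context: Write $[n]=\{1,\dots,n\}$. Multiset permutations: $S_\eta$ is the set of all words of length $n$ that are rearrangements of the trivial word $\mathrm{id}=1^{\eta_1}2^{\eta_2}\cdots r^{\eta_r}$ ($\eta_1$ copies of $1$, then $\eta_2$ copies of $2$, etc.). For $w=w_1\cdots w_n\in S_\eta$: - $\operatorname{Exc}(w)=\{i\in[n]: w_i>\mathrm{id}_i\}$ and $\operatorname{exc}(w)=|\operatorname{Exc}(w)|$. - If $\operatorname{Exc}(w)=\{i_1<\dots<i_k\}$, the exceeding subword is $E(w)=w_{i_1}\cdots w_{i_k}$; if $[n]\setminus\operatorname{Exc}(w)=\{j_1<\dots<j_{n-k}\}$, the non-exceeding subword is $N(w)=w_{j_1}\cdots w_{j_{n-k}}$. - For a word $u=u_1\cdots u_m$, $\operatorname{inv}(u)=|\{(i,j):i<j,\ u_i>u_j\}|$ and $\operatorname{imv}(u)=|\{(i,j):i<j,\ u_i\ge u_j\}|$. - $\operatorname{den}_H(w)=\sum_{i\in\operatorname{Exc}(w)} i+\operatorname{imv}(E(w))+\operatorname{inv}(N(w))$. Admissible permutations: the block map $\pi_\eta:[n]\to[r]$ sends $i$ to the unique $k$ with $\sum_{l<k}\eta_l<i\le\sum_{l\le k}\eta_l$.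 A permutation $\sigma\in S_n$ is $\eta$-admissible if $\sigma(i)<\sigma(j)$ whenever $i<j$ and $\pi_\eta(i)=\pi_\eta(j)$; $S^\eta$ denotes the set of $\eta$-admissible permutations. For $\sigma\in S_n$: - $I_\sigma=\{j\in[n]:\pi_\eta(\sigma^{ -1}(j))>\pi_\eta(j)\}$ and $\operatorname{iexc}(\sigma)=|I_\sigma|$. - $N^+_\sigma=\{(i,j)\in[n]^2:\pi_\eta(i)\le\pi_\eta(j),\ \sigma(i)<j,\ \sigma^{ -1}(j)<i\}$. - $N^-_\sigma=\{(i,j)\in[n]^2:\pi_\eta(i)>\pi_\eta(j),\ \sigma(i)<j,\ \sigma^{ -1}(j)>i\}$. - $\operatorname{den}(\sigma)=\sum_{j\in I_\sigma} j+|N^+_\sigma|-|N^-_\sigma|-\operatorname{iexc}(\sigma)$. -}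

module Defs where

open import Data.Bool using (Bool; true; false; if_then_else_; _∧_; T)
open import Data.Nat using (ℕ; zero; suc; _+_; _∸_; _≤ᵇ_; _<ᵇ_; _≡ᵇ_)
open import Data.Integer as ℤ using (ℤ; +_)
open import Data.List using (List; []; _∷_; _++_; map; concatMap; upTo; replicate; length; filter)
open import Data.Nat.ListAction using (sum)
open import Data.Bool.ListAction using (and)
open import Data.Maybe using (Maybe; just; nothing)
open import Data.Product using (_×_; _,_)
open import Relation.Nullary.Decidable using (T?)

-- Conventions: positions and letters are 1-based natural numbers.
-- A composition η = (η₁,…,ηᵣ) is a List ℕ; n = sum η, r = length η.

range : ℕ → List ℕ
range m = map suc (upTo m)

countB : {A : Set} → (A → Bool) → List A → ℕ
countB p [] = 0
countB p (x ∷ xs) = if p x then suc (countB p xs) else countB p xs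

sumB : (ℕ → Bool) → List ℕ → ℕ
sumB p [] = 0
sumB p (x ∷ xs) = if p x then x + sumB p xs else sumB p xs

pairs : ℕ → List (ℕ × ℕ)
pairs m = concatMap (λ i → map (λ j → (i , j)) (range m)) (range m)

-- 1-based lookup u_i (default 0 outside the range)
at : List ℕ → ℕ → ℕ
at [] i = 0
at (x ∷ xs) zero = 0
at (x ∷ xs) (suc zero) = x
at (x ∷ xs) (suc (suc i)) = at xs (suc i)

-- 1-based position of the first occurrence of j (default 0 if absent);
-- for a permutation σ in one-line notation this is σ⁻¹(j)
pos : List ℕ → ℕ → ℕ
pos [] j = 0
pos (x ∷ xs) j = if x ≡ᵇ j then 1 else (if pos xs j ≡ᵇ 0 then 0 else suc (pos xs j))

words : ℕ → ℕ → List (List ℕ)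
words zero m = [] ∷ []
words (suc n) m = concatMap (λ a → map (a ∷_) (words n m)) (range m)

removeFirst : ℕ → List ℕ → Maybe (List ℕ)
removeFirst x [] = nothing
removeFirst x (y ∷ ys) with x ≡ᵇ y
... | true = just ys
... | false with removeFirst x ys
...   | just zs = just (y ∷ zs)
...   | nothing = nothing

isRearr : List ℕ → List ℕ → Bool
isRearr [] [] = true
isRearr [] (_ ∷ _) = false
isRearr (x ∷ xs) ys with removeFirst x ys
... | just zs = isRearr xs zs
... | nothing = false

blk : List ℕ → ℕ → ℕ
blk [] i = 0
blk (e ∷ es) i = if i ≤ᵇ e then 1 else suc (blk es (i ∸ e))

nOf : List ℕ → ℕ
nOf η = sum η

idWordFrom : List ℕ → ℕ → List ℕ
idWordFrom [] k = []
idWordFrom (e ∷ es) k = replicate e k ++ idWordFrom es (suc k)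

idWord : List ℕ → List ℕ
idWord η = idWordFrom η 1

Sη : List ℕ → List (List ℕ)
Sη η = filter (λ w → T? (isRearr w (idWord η))) (words (nOf η) (length η))

isExc : List ℕ → List ℕ → ℕ → Bool
isExc η w i = at (idWord η) i <ᵇ at w i

exc : List ℕ → List ℕ → ℕ
exc η w = countB (isExc η w) (range (nOf η))

subword : (ℕ → Bool) → List ℕ → List ℕ
subword p w = map (at w) (filter (λ i → T? (p i)) (range (length w)))

Eword : List ℕ → List ℕ → List ℕ
Eword η w = subword (isExc η w) w

Nword : List ℕ → List ℕ → List ℕ
Nword η w = subword (λ i → if isExc η w i then false else true) w

inv : List ℕ → ℕ
inv u = countB (λ p → let i = Data.Product.proj₁ p ; j = Data.Product.proj₂ p in
                       (i <ᵇ j) ∧ (at u j <ᵇ at u i)) (pairs (length u))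

imv : List ℕ → ℕ
imv u = countB (λ p → let i = Data.Product.proj₁ p ; j = Data.Product.proj₂ p in
                       (i <ᵇ j) ∧ (at u j ≤ᵇ at u i)) (pairs (length u))

denH : List ℕ → List ℕ → ℕ
denH η w = sumB (isExc η w) (range (nOf η)) + imv (Eword η w) + inv (Nword η w)

Sn : ℕ → List (List ℕ)
Sn n = filter (λ s → T? (isRearr s (range n))) (words n n)

isAdmissible : List ℕ → List ℕ → Bool
isAdmissible η σ =
  and (map (λ p → let i = Data.Product.proj₁ p ; j = Data.Product.proj₂ p in
              if (i <ᵇ j) ∧ (blk η i ≡ᵇ blk η j) then at σ i <ᵇ at σ j else true)
           (pairs (nOf η)))

Sup : List ℕ → List (List ℕ)
Sup η = filter (λ σ → T? (isAdmissible η σ)) (Sn (nOf η))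

inI : List ℕ → List ℕ → ℕ → Bool
inI η σ j = blk η j <ᵇ blk η (pos σ j)

iexc : List ℕ → List ℕ → ℕ
iexc η σ = countB (inI η σ) (range (nOf η))

Nplus : List ℕ → List ℕ → ℕ
Nplus η σ = countB (λ p → let i = Data.Product.proj₁ p ; j = Data.Product.proj₂ p in
                     (blk η i ≤ᵇ blk η j) ∧ (at σ i <ᵇ j) ∧ (pos σ j <ᵇ i)) (pairs (nOf η))

Nminus : List ℕ → List ℕ → ℕ
Nminus η σ = countB (λ p → let i = Data.Product.proj₁ p ; j = Data.Product.proj₂ p in
                     (blk η j <ᵇ blk η i) ∧ (at σ i <ᵇ j) ∧ (i <ᵇ pos σ j)) (pairs (nOf η))

den : List ℕ → List ℕ → ℤ
den η σ = (+ (sumB (inI η σ) (range (nOf η)) + Nplus η σ)) ℤ.- (+ (Nminus η σ + iexc η σ))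

module Submission where

-- The bijection S^η → S_η is σ ↦ w with w_j = π_η(σ⁻¹(j)). Admissibility forces σ to enumerate,
-- block by block and increasingly, the positions of each letter of w, which gives the inverse.
-- Under it I_σ = Exc(w), so iexc = exc and the excedance sums agree; for k < j, admissibility
-- also makes σ⁻¹(j) < σ⁻¹(k) equivalent to w_j < w_k. After reindexing by k = σ(i) what remains
-- is |N⁺| = |N⁻| + iexc + imv(E(w)) + inv(N(w)), checked row by row: a non-excedance row of N⁺
-- is an inv(N(w)) row, and an excedance row counts the downward crossings of the level w_k by
-- the rearrangement w of π_η, which equal the upward ones.

open import Defs
open import Data.Bool using (Bool; true; false; if_then_else_; _∧_; not; T)
open import Data.Bool.Properties using (∧-zeroʳ; ∧-identityʳ; ∧-assoc; ∧-comm)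
open import Data.Integer as ℤ using (ℤ; +_; _⊖_)
import Data.Integer.Properties as ℤ
open import Data.List using (List; []; _∷_; _++_; map; concat; concatMap; upTo; replicate; length; filter)
import Data.List.Properties as List
open import Data.List.Membership.Propositional using (_∈_; lose; find)
open import Data.List.Membership.Propositional.Properties using (∈-map⁺; ∈-map⁻; ∈-filter⁺; ∈-filter⁻; ∈-concatMap⁺; ∈-concatMap⁻)
open import Data.List.Membership.Propositional.Properties.WithK using (unique∧set⇒bag)
open import Data.List.Relation.Binary.BagAndSetEquality using (∼bag⇒↭)
open import Data.List.Relation.Binary.Disjoint.Propositional using (Disjoint)
open import Data.List.Relation.Binary.Permutation.Propositional
  using (_↭_; ↭-refl; ↭-sym; ↭-trans; ↭-prep; ↭-swap; ↭-reflexive; ↭⇒↭ₛ; module PermutationReasoning)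
open import Data.List.Relation.Binary.Permutation.Propositional.Properties using (∈-resp-↭; ↭-length; drop-∷; map⁺)
import Data.List.Relation.Binary.Permutation.Setoid.Properties as ↭ₛ
open import Data.List.Relation.Unary.All using (All; []; _∷_; lookup; tabulate)
open import Data.List.Relation.Unary.All.Properties using (all⁺; all⁻)
open import Data.List.Relation.Unary.AllPairs as AllPairs using (AllPairs; []; _∷_)
import Data.List.Relation.Unary.AllPairs.Properties as AllPairs
open import Data.List.Relation.Unary.Any using (here; there)
open import Data.List.Relation.Unary.Unique.Propositional using (Unique)
import Data.List.Relation.Unary.Unique.Propositional.Properties as Unique
open import Data.Maybe using (just)
open import Data.Nat
open import Data.Nat.ListAction using (sum)
open import Data.Nat.ListAction.Properties using (sum-++; sum-↭)
open import Data.Nat.Properties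
open import Algebra.Properties.CommutativeSemigroup +-commutativeSemigroup using () renaming (interchange to +-interchange)
open import Data.Nat.Solver using (module +-*-Solver)
open import Data.Product using (_×_; _,_; proj₁; proj₂; Σ-syntax)
open import Data.Unit using (tt)
open import Function using (_∘_)
open import Function.Bundles using (mk⇔)
open import Relation.Binary.Definitions using (tri<; tri≈; tri>)
open import Relation.Binary.PropositionalEquality
open import Relation.Nullary using (¬_; yes; no; contradiction)
open import Relation.Nullary.Decidable using (T?)
open import Relation.Nullary.Reflects using (Reflects; ofʸ; ofⁿ; invert; fromEquivalence)

variable
  A B : Set

module _ {p} {P : Set p} {b : Bool} where

  reflects-true : Reflects P b → P → b ≡ true
  reflects-true (ofʸ _) _ = refl
  reflects-true (ofⁿ ¬p) p = contradiction p ¬p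

  reflects-false : Reflects P b → ¬ P → b ≡ false
  reflects-false (ofʸ p) ¬p = contradiction p ¬p
  reflects-false (ofⁿ _) _ = refl

  true-reflects : Reflects P b → b ≡ true → P
  true-reflects r refl = invert r

  false-reflects : Reflects P b → b ≡ false → ¬ P
  false-reflects r refl = invert r

≡ᵇ-reflects-≡ : ∀ m n → Reflects (m ≡ n) (m ≡ᵇ n)
≡ᵇ-reflects-≡ m n = fromEquivalence (≡ᵇ⇒≡ m n) (≡⇒≡ᵇ m n)

module _ {m n : ℕ} where

  ≡ᵇ-true : m ≡ n → (m ≡ᵇ n) ≡ true
  ≡ᵇ-true = reflects-true (≡ᵇ-reflects-≡ m n)

  ≡ᵇ-false : m ≢ n → (m ≡ᵇ n) ≡ false
  ≡ᵇ-false = reflects-false (≡ᵇ-reflects-≡ m n)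

  ≡ᵇ-true⇒≡ : (m ≡ᵇ n) ≡ true → m ≡ n
  ≡ᵇ-true⇒≡ = true-reflects (≡ᵇ-reflects-≡ m n)

  ≡ᵇ-false⇒≢ : (m ≡ᵇ n) ≡ false → m ≢ n
  ≡ᵇ-false⇒≢ = false-reflects (≡ᵇ-reflects-≡ m n)

  <ᵇ-true : m < n → (m <ᵇ n) ≡ true
  <ᵇ-true = reflects-true (<ᵇ-reflects-< m n)

  <ᵇ-false : ¬ m < n → (m <ᵇ n) ≡ false
  <ᵇ-false = reflects-false (<ᵇ-reflects-< m n)

  ≤ᵇ-true : m ≤ n → (m ≤ᵇ n) ≡ true
  ≤ᵇ-true = reflects-true (≤ᵇ-reflects-≤ m n)

  ≤ᵇ-false : ¬ m ≤ n → (m ≤ᵇ n) ≡ false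
  ≤ᵇ-false = reflects-false (≤ᵇ-reflects-≤ m n)

  ≤ᵇ-true⇒≤ : (m ≤ᵇ n) ≡ true → m ≤ n
  ≤ᵇ-true⇒≤ = true-reflects (≤ᵇ-reflects-≤ m n)

  ≤ᵇ-false⇒≰ : (m ≤ᵇ n) ≡ false → ¬ m ≤ n
  ≤ᵇ-false⇒≰ = false-reflects (≤ᵇ-reflects-≤ m n)

⟦_⟧ : Bool → ℕ
⟦ b ⟧ = if b then 1 else 0

Σ : (A → ℕ) → List A → ℕ
Σ f xs = sum (map f xs)

countB≡Σ : (p : A → Bool) (xs : List A) → countB p xs ≡ Σ (λ x → ⟦ p x ⟧) xs
countB≡Σ p [] = refl
countB≡Σ p (x ∷ xs) with p x
... | true = cong suc (countB≡Σ p xs)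
... | false = countB≡Σ p xs

length-filter≡Σ : (p : A → Bool) (xs : List A) → length (filter (T? ∘ p) xs) ≡ Σ (λ x → ⟦ p x ⟧) xs
length-filter≡Σ p [] = refl
length-filter≡Σ p (x ∷ xs) with p x
... | true = cong suc (length-filter≡Σ p xs)
... | false = length-filter≡Σ p xs

Σ-cong : {f g : A → ℕ} (xs : List A) → (∀ {x} → x ∈ xs → f x ≡ g x) → Σ f xs ≡ Σ g xs
Σ-cong xs f≗g = cong sum (List.map-cong-local (tabulate f≗g))

Σ-++ : (f : A → ℕ) (xs ys : List A) → Σ f (xs ++ ys) ≡ Σ f xs + Σ f ys
Σ-++ f xs ys = trans (cong sum (List.map-++ f xs ys)) (sum-++ (map f xs) (map f ys))

Σ-↭ : (f : A → ℕ) {xs ys : List A} → xs ↭ ys → Σ f xs ≡ Σ f ys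
Σ-↭ f xs↭ys = sum-↭ (map⁺ f xs↭ys)

Σ-+ : (f g : A → ℕ) (xs : List A) → Σ (λ x → f x + g x) xs ≡ Σ f xs + Σ g xs
Σ-+ f g [] = refl
Σ-+ f g (x ∷ xs) = trans (cong (_+_ (f x + g x)) (Σ-+ f g xs)) (+-interchange (f x) (g x) (Σ f xs) (Σ g xs))

Σ-zero : (xs : List A) → Σ (λ _ → 0) xs ≡ 0
Σ-zero [] = refl
Σ-zero (x ∷ xs) = Σ-zero xs

Σ-filter : (f : A → ℕ) (p : A → Bool) (xs : List A) →
  Σ f (filter (T? ∘ p) xs) ≡ Σ (λ x → if p x then f x else 0) xs
Σ-filter f p [] = refl
Σ-filter f p (x ∷ xs) with p x
... | true = cong (_+_ (f x)) (Σ-filter f p xs)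
... | false = Σ-filter f p xs

Σ-map : (f : B → ℕ) (g : A → B) (xs : List A) → Σ f (map g xs) ≡ Σ (f ∘ g) xs
Σ-map f g xs = cong sum (sym (List.map-∘ xs))

Σ-concatMap : (f : B → ℕ) (g : A → List B) (xs : List A) →
  Σ f (concatMap g xs) ≡ Σ (Σ f ∘ g) xs
Σ-concatMap f g [] = refl
Σ-concatMap f g (x ∷ xs) = trans (Σ-++ f (g x) (concatMap g xs)) (cong (_+_ (Σ f (g x))) (Σ-concatMap f g xs))

Σ-swap : (F : A → B → ℕ) (xs : List A) (ys : List B) →
  Σ (λ x → Σ (F x) ys) xs ≡ Σ (λ y → Σ (λ x → F x y) xs) ys
Σ-swap F [] ys = sym (Σ-zero ys)
Σ-swap F (x ∷ xs) ys = begin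
  Σ (F x) ys + Σ (λ x′ → Σ (F x′) ys) xs          ≡⟨ cong (_+_ (Σ (F x) ys)) (Σ-swap F xs ys) ⟩
  Σ (F x) ys + Σ (λ y → Σ (λ x′ → F x′ y) xs) ys  ≡⟨ Σ-+ (F x) (λ y → Σ (λ x′ → F x′ y) xs) ys ⟨
  Σ (λ y → F x y + Σ (λ x′ → F x′ y) xs) ys      ∎
  where open ≡-Reasoning

sumB≡Σ : (p : ℕ → Bool) (xs : List ℕ) → sumB p xs ≡ Σ (λ x → if p x then x else 0) xs
sumB≡Σ p [] = refl
sumB≡Σ p (x ∷ xs) with p x
... | true = cong (_+_ x) (sumB≡Σ p xs)
... | false = sumB≡Σ p xs

InRange : ℕ → ℕ → Set
InRange m x = 1 ≤ x × x ≤ m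

range-suc : ∀ m → range (suc m) ≡ 1 ∷ map suc (range m)
range-suc m = cong (λ xs → 1 ∷ map suc xs) (sym (List.map-upTo suc m))

range-snoc : ∀ m → range (suc m) ≡ range m ++ suc m ∷ []
range-snoc m = trans (cong (map suc) (sym (List.upTo-∷ʳ m))) (List.map-++ suc (upTo m) (m ∷ []))

range-+ : ∀ a b → range (a + b) ≡ range a ++ map (_+_ a) (range b)
range-+ zero b = sym (List.map-id (range b))
range-+ (suc a) b = begin
  range (suc (a + b))                                        ≡⟨ range-suc (a + b) ⟩
  1 ∷ map suc (range (a + b))                                ≡⟨ cong (λ xs → 1 ∷ map suc xs) (range-+ a b) ⟩
  1 ∷ map suc (range a ++ map (_+_ a) (range b))             ≡⟨ cong (1 ∷_) (List.map-++ suc (range a) _) ⟩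
  1 ∷ (map suc (range a) ++ map suc (map (_+_ a) (range b))) ≡⟨ cong (λ xs → 1 ∷ (map suc (range a) ++ xs)) (List.map-∘ (range b)) ⟨
  1 ∷ (map suc (range a) ++ map (_+_ (suc a)) (range b))     ≡⟨ cong (_++ map (_+_ (suc a)) (range b)) (range-suc a) ⟨
  range (suc a) ++ map (_+_ (suc a)) (range b)               ∎
  where open ≡-Reasoning

length-range : ∀ m → length (range m) ≡ m
length-range m = trans (List.length-map suc (upTo m)) (List.length-upTo m)

∈-range⁻ : ∀ {m x} → x ∈ range m → InRange m x
∈-range⁻ {suc m} x∈ rewrite range-suc m with x∈
... | here refl = s≤s z≤n , s≤s z≤n
... | there x∈′ with ∈-map⁻ suc x∈′
...   | y , y∈ , refl = s≤s z≤n , s≤s (proj₂ (∈-range⁻ y∈))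

∈-range⁺ : ∀ {m x} → InRange m x → x ∈ range m
∈-range⁺ {suc m} {suc zero} _ rewrite range-suc m = here refl
∈-range⁺ {suc m} {suc (suc x)} (_ , s≤s x≤m) rewrite range-suc m =
  there (∈-map⁺ suc (∈-range⁺ (s≤s z≤n , x≤m)))

range-unique : ∀ m → Unique (range m)
range-unique m = Unique.map⁺ suc-injective (Unique.upTo⁺ m)

Σ-range-suc : (f : ℕ → ℕ) (m : ℕ) → Σ f (range (suc m)) ≡ f 1 + Σ (f ∘ suc) (range m)
Σ-range-suc f m = trans (cong (Σ f) (range-suc m)) (cong (_+_ (f 1)) (Σ-map f suc (range m)))

Σ-range-snoc : (f : ℕ → ℕ) (m : ℕ) → Σ f (range (suc m)) ≡ Σ f (range m) + f (suc m)
Σ-range-snoc f m = begin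
  Σ f (range (suc m))               ≡⟨ cong (Σ f) (range-snoc m) ⟩
  Σ f (range m ++ suc m ∷ [])       ≡⟨ Σ-++ f (range m) (suc m ∷ []) ⟩
  Σ f (range m) + (f (suc m) + 0)   ≡⟨ cong (_+_ (Σ f (range m))) (+-identityʳ (f (suc m))) ⟩
  Σ f (range m) + f (suc m)         ∎
  where open ≡-Reasoning

Σ-range-⟦≡ᵇ⟧ : ∀ n k → InRange n k → Σ (λ j → ⟦ j ≡ᵇ k ⟧) (range n) ≡ 1
Σ-range-⟦≡ᵇ⟧ zero k (1≤k , k≤0) = contradiction (≤-trans 1≤k k≤0) λ ()
Σ-range-⟦≡ᵇ⟧ (suc n) k (1≤k , k≤1+n) rewrite Σ-range-snoc (λ j → ⟦ j ≡ᵇ k ⟧) n with k ≟ suc n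
... | yes refl rewrite ≡ᵇ-true {suc n} refl =
  cong (_+ 1) (trans (Σ-cong (range n) λ j∈ → cong ⟦_⟧ (≡ᵇ-false (<⇒≢ (s≤s (proj₂ (∈-range⁻ j∈)))))) (Σ-zero (range n)))
... | no k≢1+n rewrite ≡ᵇ-false {suc n} {k} (k≢1+n ∘ sym) =
  trans (+-identityʳ _) (Σ-range-⟦≡ᵇ⟧ n k (1≤k , ≤-pred (≤∧≢⇒< k≤1+n k≢1+n)))

at-suc : ∀ (x : ℕ) xs i → 1 ≤ i → at (x ∷ xs) (suc i) ≡ at xs i
at-suc x xs (suc zero) _ = refl
at-suc x xs (suc (suc i)) _ = refl

at-∈ : ∀ (xs : List ℕ) i → InRange (length xs) i → at xs i ∈ xs
at-∈ (x ∷ xs) (suc zero) _ = here refl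
at-∈ (x ∷ xs) (suc (suc i)) (_ , s≤s i≤) = there (at-∈ xs (suc i) (s≤s z≤n , i≤))

at-map : ∀ (g : ℕ → ℕ) (xs : List ℕ) i → InRange (length xs) i → at (map g xs) i ≡ g (at xs i)
at-map g (x ∷ xs) (suc zero) _ = refl
at-map g (x ∷ xs) (suc (suc i)) (_ , s≤s i≤) = at-map g xs (suc i) (s≤s z≤n , i≤)

at-++ˡ : ∀ (xs ys : List ℕ) i → InRange (length xs) i → at (xs ++ ys) i ≡ at xs i
at-++ˡ (x ∷ xs) ys (suc zero) _ = refl
at-++ˡ (x ∷ xs) ys (suc (suc i)) (_ , s≤s i≤) = at-++ˡ xs ys (suc i) (s≤s z≤n , i≤)

at-++ʳ : ∀ (xs ys : List ℕ) i → 1 ≤ i → at (xs ++ ys) (length xs + i) ≡ at ys i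
at-++ʳ [] ys i _ = refl
at-++ʳ (x ∷ xs) ys (suc i) _ =
  trans (at-suc x (xs ++ ys) (length xs + suc i) (subst (1 ≤_) (sym (+-suc (length xs) i)) (s≤s z≤n)))
        (at-++ʳ xs ys (suc i) (s≤s z≤n))

map-at-range : ∀ (xs : List ℕ) → map (at xs) (range (length xs)) ≡ xs
map-at-range [] = refl
map-at-range (x ∷ xs) = begin
  map (at (x ∷ xs)) (range (suc (length xs)))       ≡⟨ cong (map (at (x ∷ xs))) (range-suc (length xs)) ⟩
  x ∷ map (at (x ∷ xs)) (map suc (range (length xs))) ≡⟨ cong (x ∷_) (List.map-∘ (range (length xs))) ⟨
  x ∷ map (at (x ∷ xs) ∘ suc) (range (length xs))     ≡⟨ cong (x ∷_) (List.map-cong-local (tabulate λ i∈ → at-suc x xs _ (proj₁ (∈-range⁻ i∈)))) ⟩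
  x ∷ map (at xs) (range (length xs))                 ≡⟨ cong (x ∷_) (map-at-range xs) ⟩
  x ∷ xs                                              ∎
  where open ≡-Reasoning

at-range : ∀ m i → InRange m i → at (range m) i ≡ i
at-range (suc m) (suc zero) _ = cong (λ xs → at xs 1) (range-suc m)
at-range (suc m) (suc (suc i)) (_ , s≤s i≤m) = begin
  at (range (suc m)) (suc (suc i))  ≡⟨ cong (λ xs → at xs (suc (suc i))) (range-suc m) ⟩
  at (map suc (range m)) (suc i)    ≡⟨ at-map suc (range m) (suc i) (s≤s z≤n , subst (suc i ≤_) (sym (length-range m)) i≤m) ⟩
  suc (at (range m) (suc i))        ≡⟨ cong suc (at-range m (suc i) (s≤s z≤n , i≤m)) ⟩
  suc (suc i)                       ∎
  where open ≡-Reasoning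

pos-spec : ∀ {x} (xs : List ℕ) → x ∈ xs → InRange (length xs) (pos xs x) × at xs (pos xs x) ≡ x
pos-spec {x} (y ∷ ys) x∈ with y ≡ᵇ x in y≡ᵇx
... | true = (s≤s z≤n , s≤s z≤n) , ≡ᵇ-true⇒≡ y≡ᵇx
pos-spec {x} (y ∷ ys) (here refl) | false = contradiction refl (≡ᵇ-false⇒≢ {y} {y} y≡ᵇx)
pos-spec {x} (y ∷ ys) (there x∈) | false with pos-spec ys x∈
... | (1≤pos , pos≤) , at-pos with pos ys x
...   | suc k = (s≤s z≤n , s≤s pos≤) , trans (at-suc y ys (suc k) (s≤s z≤n)) at-pos

pos-at : ∀ (xs : List ℕ) → Unique xs → ∀ i → InRange (length xs) i → pos xs (at xs i) ≡ i
pos-at (x ∷ xs) _ (suc zero) _ rewrite ≡ᵇ-true {x} {x} refl = refl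
pos-at (x ∷ xs) (x∉ ∷ u) (suc (suc i)) (_ , s≤s i≤) with x ≡ᵇ at xs (suc i) in x≡ᵇ
... | true = contradiction (≡ᵇ-true⇒≡ x≡ᵇ) (lookup x∉ (at-∈ xs (suc i) (s≤s z≤n , i≤)))
... | false rewrite pos-at xs u (suc i) (s≤s z≤n , i≤) = refl

Increasing : List ℕ → Set
Increasing = AllPairs _<_

range-increasing : ∀ m → Increasing (range m)
range-increasing zero = []
range-increasing (suc m) rewrite range-suc m =
  tabulate 1<x ∷ AllPairs.map⁺ (AllPairs.map s≤s (range-increasing m))
  where
  1<x : ∀ {x} → x ∈ map suc (range m) → 1 < x
  1<x x∈ with ∈-map⁻ suc x∈
  ... | y , y∈ , refl = s≤s (proj₁ (∈-range⁻ y∈))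

increasing-map : (h : ℕ → ℕ) (xs : List ℕ) → Increasing xs →
  (∀ {x y} → x ∈ xs → y ∈ xs → x < y → h x < h y) → Increasing (map h xs)
increasing-map h [] _ _ = []
increasing-map h (x ∷ xs) (x< ∷ inc) h-mono =
  tabulate hx< ∷ increasing-map h xs inc (λ x∈ y∈ → h-mono (there x∈) (there y∈))
  where
  hx< : ∀ {z} → z ∈ map h xs → h x < z
  hx< z∈ with ∈-map⁻ h z∈
  ... | y , y∈ , refl = h-mono (here refl) (there y∈) (lookup x< y∈)

increasing-at : ∀ (xs : List ℕ) → Increasing xs →
  ∀ k l → 1 ≤ k → k < l → l ≤ length xs → at xs k < at xs l
increasing-at (x ∷ xs) _ (suc zero) (suc zero) _ (s≤s ()) _
increasing-at (x ∷ xs) (x< ∷ _) (suc zero) (suc (suc l)) _ _ (s≤s l≤) = lookup x< (at-∈ xs (suc l) (s≤s z≤n , l≤))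
increasing-at (x ∷ xs) (_ ∷ inc) (suc (suc k)) (suc (suc l)) _ (s≤s k<l) (s≤s l≤) =
  increasing-at xs inc (suc k) (suc l) (s≤s z≤n) k<l l≤

increasing-at⁻ : ∀ (xs : List ℕ) → Increasing xs →
  ∀ k l → InRange (length xs) k → InRange (length xs) l → at xs k < at xs l → k < l
increasing-at⁻ xs inc k l (1≤k , k≤) (1≤l , l≤) lt with <-cmp k l
... | tri< k<l _ _ = k<l
... | tri≈ _ refl _ = contradiction lt (<-irrefl refl)
... | tri> _ _ l<k = contradiction lt (<-asym (increasing-at xs inc l k 1≤l l<k k≤))

SameElements : List A → List A → Set
SameElements xs ys = (∀ {x} → x ∈ xs → x ∈ ys) × (∀ {x} → x ∈ ys → x ∈ xs)

increasing-≡ : ∀ (xs ys : List ℕ) → Increasing xs → Increasing ys → SameElements xs ys → xs ≡ ys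
increasing-≡ [] [] _ _ _ = refl
increasing-≡ [] (y ∷ ys) _ _ (_ , ⊇) with ⊇ (here refl)
... | ()
increasing-≡ (x ∷ xs) [] _ _ (⊆ , _) with ⊆ (here refl)
... | ()
increasing-≡ (x ∷ xs) (y ∷ ys) (x< ∷ incx) (y< ∷ incy) (⊆ , ⊇) with ⊆ (here refl) | ⊇ (here refl)
... | here refl | _ = cong (x ∷_) (increasing-≡ xs ys incx incy (tail x< ⊆ , tail y< ⊇))
  where
  tail : ∀ {a as bs} → All (a <_) as → (∀ {z} → z ∈ a ∷ as → z ∈ a ∷ bs) → ∀ {z} → z ∈ as → z ∈ bs
  tail x< ⊆′ z∈ with ⊆′ (there z∈)
  ... | here refl = contradiction (lookup x< z∈) (<-irrefl refl)
  ... | there z∈′ = z∈′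
... | there x∈ys | here refl = contradiction (lookup y< x∈ys) (<-irrefl refl)
... | there x∈ys | there y∈xs = contradiction (lookup x< y∈xs) (<-asym (lookup y< x∈ys))

unique-map : (h : A → B) {xs : List A} → Unique xs →
  (∀ {x y} → x ∈ xs → y ∈ xs → h x ≡ h y → x ≡ y) → Unique (map h xs)
unique-map h {[]} _ _ = []
unique-map h {x ∷ xs} (x∉ ∷ u) injective =
  tabulate hx≢ ∷ unique-map h u (λ x∈ y∈ → injective (there x∈) (there y∈))
  where
  hx≢ : ∀ {z} → z ∈ map h xs → h x ≢ z
  hx≢ z∈ eq with ∈-map⁻ h z∈
  ... | y , y∈ , refl = lookup x∉ y∈ (injective (here refl) (there y∈) eq)

unique-↭ : {xs ys : List A} → Unique xs → Unique ys → SameElements xs ys → xs ↭ ys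
unique-↭ ux uy (⊆ , ⊇) = ∼bag⇒↭ (unique∧set⇒bag ux uy (mk⇔ ⊆ ⊇))

∈-words⁺ : ∀ n m (u : List ℕ) → length u ≡ n → All (InRange m) u → u ∈ words n m
∈-words⁺ zero m [] refl [] = here refl
∈-words⁺ (suc n) m (x ∷ u) refl (x∈ ∷ u∈) =
  ∈-concatMap⁺ (λ a → map (a ∷_) (words n m)) (lose (∈-range⁺ x∈) (∈-map⁺ (x ∷_) (∈-words⁺ n m u refl u∈)))

∈-words⁻ : ∀ n m (u : List ℕ) → u ∈ words n m → length u ≡ n × All (InRange m) u
∈-words⁻ zero m [] _ = refl , []
∈-words⁻ zero m (x ∷ u) (here ())
∈-words⁻ zero m (x ∷ u) (there ())
∈-words⁻ (suc n) m u u∈ with find (∈-concatMap⁻ (λ a → map (a ∷_) (words n m)) {xs = range m} u∈)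
... | a , a∈ , u∈′ with ∈-map⁻ (a ∷_) u∈′
...   | v , v∈ , refl with ∈-words⁻ n m v v∈
...     | len , all = cong suc len , ∈-range⁻ a∈ ∷ all

words-unique : ∀ n m → Unique (words n m)
words-unique zero m = [] ∷ []
words-unique (suc n) m = prefixed-unique (range m) (range-unique m)
  where
  prefixed : ℕ → List (List ℕ)
  prefixed a = map (a ∷_) (words n m)
  prefixed-unique : (as : List ℕ) → Unique as → Unique (concatMap prefixed as)
  prefixed-unique [] _ = []
  prefixed-unique (a ∷ as) (a∉ ∷ u) =
    Unique.++⁺ (Unique.map⁺ List.∷-injectiveʳ (words-unique n m)) (prefixed-unique as u) disjoint
    where
    disjoint : Disjoint (prefixed a) (concatMap prefixed as)
    disjoint (v∈ , v∈′) with ∈-map⁻ (a ∷_) v∈ | find (∈-concatMap⁻ prefixed {xs = as} v∈′)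
    ... | _ , _ , refl | b , b∈ , v∈b with ∈-map⁻ (b ∷_) v∈b
    ...   | _ , _ , a∷≡b∷ = lookup a∉ b∈ (List.∷-injectiveˡ a∷≡b∷)

removeFirst-just : ∀ x (ys : List ℕ) {zs} → removeFirst x ys ≡ just zs → ys ↭ x ∷ zs
removeFirst-just x (y ∷ ys) eq with x ≡ᵇ y in x≡ᵇy
removeFirst-just x (y ∷ ys) refl | true rewrite ≡ᵇ-true⇒≡ {x} {y} x≡ᵇy = ↭-refl
removeFirst-just x (y ∷ ys) eq | false with removeFirst x ys in eq′
removeFirst-just x (y ∷ ys) refl | false | just zs = ↭-trans (↭-prep y (removeFirst-just x ys eq′)) (↭-swap y x ↭-refl)

removeFirst-∈ : ∀ x (ys : List ℕ) → x ∈ ys → Σ[ zs ∈ List ℕ ] removeFirst x ys ≡ just zs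
removeFirst-∈ x (y ∷ ys) x∈ with x ≡ᵇ y in x≡ᵇy
... | true = ys , refl
removeFirst-∈ x (y ∷ ys) (here refl) | false = contradiction refl (≡ᵇ-false⇒≢ {x} {x} x≡ᵇy)
removeFirst-∈ x (y ∷ ys) (there x∈) | false with removeFirst-∈ x ys x∈
... | zs , eq rewrite eq = y ∷ zs , refl

isRearr-sound : ∀ (xs ys : List ℕ) → T (isRearr xs ys) → xs ↭ ys
isRearr-sound [] [] _ = ↭-refl
isRearr-sound (x ∷ xs) ys t with removeFirst x ys in eq
... | just zs = ↭-trans (↭-prep x (isRearr-sound xs zs t)) (↭-sym (removeFirst-just x ys eq))

isRearr-complete : ∀ (xs ys : List ℕ) → xs ↭ ys → T (isRearr xs ys)
isRearr-complete [] [] _ = tt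
isRearr-complete [] (y ∷ ys) p with ↭-length p
... | ()
isRearr-complete (x ∷ xs) ys p with removeFirst-∈ x ys (∈-resp-↭ p (here refl))
... | zs , eq rewrite eq = isRearr-complete xs zs (drop-∷ (↭-trans p (removeFirst-just x ys eq)))

replicate-length : ∀ (c : A) (xs : List B) → replicate (length xs) c ≡ map (λ _ → c) xs
replicate-length c [] = refl
replicate-length c (x ∷ xs) = cong (c ∷_) (replicate-length c xs)

blk-mono : ∀ η {i j} → i ≤ j → blk η i ≤ blk η j
blk-mono [] _ = z≤n
blk-mono (e ∷ es) {i} {j} i≤j with i ≤ᵇ e in i≤ᵇe | j ≤ᵇ e in j≤ᵇe
... | true | true = ≤-refl
... | true | false = s≤s z≤n
... | false | true = contradiction (≤-trans i≤j (≤ᵇ-true⇒≤ j≤ᵇe)) (≤ᵇ-false⇒≰ i≤ᵇe)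
... | false | false = s≤s (blk-mono es (∸-monoˡ-≤ e i≤j))

blk-≤-length : ∀ η i → blk η i ≤ length η
blk-≤-length [] i = z≤n
blk-≤-length (e ∷ es) i with i ≤ᵇ e
... | true = s≤s z≤n
... | false = s≤s (blk-≤-length es (i ∸ e))

blk-InRange : ∀ η {i} → InRange (nOf η) i → InRange (length η) (blk η i)
blk-InRange [] (1≤i , i≤0) = contradiction (≤-trans 1≤i i≤0) λ ()
blk-InRange (e ∷ es) {i} _ = 1≤blk , blk-≤-length (e ∷ es) i
  where
  1≤blk : 1 ≤ blk (e ∷ es) i
  1≤blk with i ≤ᵇ e
  ... | true = s≤s z≤n
  ... | false = s≤s z≤n

idWordFrom≡map-blk : ∀ η k → idWordFrom η (suc k) ≡ map (λ j → k + blk η j) (range (nOf η))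
idWordFrom≡map-blk [] k = refl
idWordFrom≡map-blk (e ∷ es) k = begin
  replicate e (suc k) ++ idWordFrom es (suc (suc k))                ≡⟨ cong₂ _++_ first-block (idWordFrom≡map-blk es (suc k)) ⟩
  map f (range e) ++ map (λ j → suc k + blk es j) (range (nOf es))  ≡⟨ cong (map f (range e) ++_) later-blocks ⟩
  map f (range e) ++ map f (map (_+_ e) (range (nOf es)))            ≡⟨ List.map-++ f (range e) _ ⟨
  map f (range e ++ map (_+_ e) (range (nOf es)))                    ≡⟨ cong (map f) (range-+ e (nOf es)) ⟨
  map f (range (e + nOf es))                                         ∎
  where
  open ≡-Reasoning
  f : ℕ → ℕ
  f j = k + blk (e ∷ es) j
  first-block : replicate e (suc k) ≡ map f (range e)
  first-block = begin
    replicate e (suc k)                   ≡⟨ cong (λ m → replicate m (suc k)) (length-range e) ⟨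
    replicate (length (range e)) (suc k)  ≡⟨ replicate-length (suc k) (range e) ⟩
    map (λ _ → suc k) (range e)           ≡⟨ List.map-cong-local (tabulate λ j∈ → sym (f≡1+k (proj₂ (∈-range⁻ j∈)))) ⟩
    map f (range e)                       ∎
    where
    f≡1+k : ∀ {j} → j ≤ e → f j ≡ suc k
    f≡1+k j≤e rewrite ≤ᵇ-true j≤e = +-comm k 1
  later-blocks : map (λ j → suc k + blk es j) (range (nOf es)) ≡ map f (map (_+_ e) (range (nOf es)))
  later-blocks = trans (List.map-cong-local (tabulate λ j∈ → shift (proj₁ (∈-range⁻ j∈)))) (List.map-∘ (range (nOf es)))
    where
    shift : ∀ {j} → 1 ≤ j → suc k + blk es j ≡ f (e + j)
    shift {suc j} _ rewrite ≤ᵇ-false {e + suc j} {e} (m+1+n≰m e) | m+n∸m≡n e (suc j) = sym (+-suc k (blk es (suc j)))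

idWord≡map-blk : ∀ η → idWord η ≡ map (blk η) (range (nOf η))
idWord≡map-blk η = idWordFrom≡map-blk η 0

at-idWord : ∀ η j → InRange (nOf η) j → at (idWord η) j ≡ blk η j
at-idWord η j j∈ = begin
  at (idWord η) j                      ≡⟨ cong (λ xs → at xs j) (idWord≡map-blk η) ⟩
  at (map (blk η) (range (nOf η))) j   ≡⟨ at-map (blk η) (range (nOf η)) j (proj₁ j∈ , subst (j ≤_) (sym (length-range _)) (proj₂ j∈)) ⟩
  blk η (at (range (nOf η)) j)         ≡⟨ cong (blk η) (at-range _ j j∈) ⟩
  blk η j                              ∎
  where open ≡-Reasoning

ΣΣ : (ℕ → ℕ → Bool) → List ℕ → ℕ
ΣΣ F R = Σ (λ a → Σ (λ b → ⟦ F a b ⟧) R) R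

countB-pairs : ∀ (p : ℕ × ℕ → Bool) m → countB p (pairs m) ≡ ΣΣ (λ i j → p (i , j)) (range m)
countB-pairs p m = begin
  countB p (pairs m)                                            ≡⟨ countB≡Σ p (pairs m) ⟩
  Σ (⟦_⟧ ∘ p) (concatMap row (range m))                         ≡⟨ Σ-concatMap (⟦_⟧ ∘ p) row (range m) ⟩
  Σ (Σ (⟦_⟧ ∘ p) ∘ row) (range m)                               ≡⟨ Σ-cong (range m) (λ {i} _ → Σ-map (⟦_⟧ ∘ p) (i ,_) (range m)) ⟩
  ΣΣ (λ i j → p (i , j)) (range m)                              ∎
  where
  open ≡-Reasoning
  row : ℕ → List (ℕ × ℕ)
  row i = map (i ,_) (range m)

∈-pairs⁺ : ∀ {m i j} → i ∈ range m → j ∈ range m → (i , j) ∈ pairs m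
∈-pairs⁺ {m} {i} i∈ j∈ = ∈-concatMap⁺ (λ i → map (i ,_) (range m)) (lose i∈ (∈-map⁺ (i ,_) j∈))

∈-pairs⁻ : ∀ {m i j} → (i , j) ∈ pairs m → i ∈ range m × j ∈ range m
∈-pairs⁻ {m} ij∈ with find (∈-concatMap⁻ (λ i → map (i ,_) (range m)) {xs = range m} ij∈)
... | i , i∈ , ij∈′ with ∈-map⁻ (i ,_) ij∈′
...   | j , j∈ , refl = i∈ , j∈

pairCount : (ℕ → ℕ → Bool) → List ℕ → ℕ
pairCount Rb [] = 0
pairCount Rb (x ∷ xs) = Σ (λ y → ⟦ Rb x y ⟧) xs + pairCount Rb xs

positionalPairCount≡pairCount : ∀ Rb u →
  ΣΣ (λ i j → (i <ᵇ j) ∧ Rb (at u i) (at u j)) (range (length u)) ≡ pairCount Rb u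
positionalPairCount≡pairCount Rb [] = refl
positionalPairCount≡pairCount Rb (x ∷ xs) = begin
  ΣΣ (λ i j → (i <ᵇ j) ∧ Rb (at u i) (at u j)) (range (suc m))
    ≡⟨ Σ-range-suc (λ i → Σ (λ j → ⟦ (i <ᵇ j) ∧ Rb (at u i) (at u j) ⟧) (range (suc m))) m ⟩
  Σ (λ j → ⟦ (1 <ᵇ j) ∧ Rb x (at u j) ⟧) (range (suc m))
    + Σ (λ i → Σ (λ j → ⟦ (suc i <ᵇ j) ∧ Rb (at u (suc i)) (at u j) ⟧) (range (suc m))) R
    ≡⟨ cong₂ _+_ (Σ-range-suc (λ j → ⟦ (1 <ᵇ j) ∧ Rb x (at u j) ⟧) m)
                 (Σ-cong R (λ {i} _ → Σ-range-suc (λ j → ⟦ (suc i <ᵇ j) ∧ Rb (at u (suc i)) (at u j) ⟧) m)) ⟩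
  Σ (λ j → ⟦ (0 <ᵇ j) ∧ Rb x (at u (suc j)) ⟧) R
    + ΣΣ (λ i j → (i <ᵇ j) ∧ Rb (at u (suc i)) (at u (suc j))) R
    ≡⟨ cong₂ _+_ (Σ-cong R λ {j} j∈ → cong₂ (λ b y → ⟦ b ∧ Rb x y ⟧) (<ᵇ-true (1≤ j∈)) (at-suc x xs j (1≤ j∈)))
                 (Σ-cong R λ {i} i∈ → Σ-cong R λ {j} j∈ →
                   cong₂ (λ y z → ⟦ (i <ᵇ j) ∧ Rb y z ⟧) (at-suc x xs i (1≤ i∈)) (at-suc x xs j (1≤ j∈))) ⟩
  Σ (λ j → ⟦ Rb x (at xs j) ⟧) R + ΣΣ (λ i j → (i <ᵇ j) ∧ Rb (at xs i) (at xs j)) R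
    ≡⟨ cong₂ _+_ (trans (sym (Σ-map (λ y → ⟦ Rb x y ⟧) (at xs) R)) (cong (Σ (λ y → ⟦ Rb x y ⟧)) (map-at-range xs)))
                 (positionalPairCount≡pairCount Rb xs) ⟩
  pairCount Rb (x ∷ xs) ∎
  where
  open ≡-Reasoning
  u = x ∷ xs
  m = length xs
  R = range m
  1≤ : ∀ {i} → i ∈ R → 1 ≤ i
  1≤ = proj₁ ∘ ∈-range⁻

pairCount-map : ∀ Rb (h : ℕ → ℕ) xs → pairCount Rb (map h xs) ≡ pairCount (λ a b → Rb (h a) (h b)) xs
pairCount-map Rb h [] = refl
pairCount-map Rb h (x ∷ xs) = cong₂ _+_ (Σ-map (λ y → ⟦ Rb (h x) y ⟧) h xs) (pairCount-map Rb h xs)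

pairCount-filter : ∀ Rb (p : ℕ → Bool) xs →
  pairCount Rb (filter (T? ∘ p) xs) ≡ pairCount (λ a b → p a ∧ (p b ∧ Rb a b)) xs
pairCount-filter Rb p [] = refl
pairCount-filter Rb p (x ∷ xs) with p x
... | true = cong₂ _+_ (trans (Σ-filter (λ y → ⟦ Rb x y ⟧) p xs) (Σ-cong xs λ {y} _ → if≡⟦∧⟧ (p y)))
                       (pairCount-filter Rb p xs)
  where
  if≡⟦∧⟧ : ∀ {y} b → (if b then ⟦ Rb x y ⟧ else 0) ≡ ⟦ b ∧ Rb x y ⟧
  if≡⟦∧⟧ true = refl
  if≡⟦∧⟧ false = refl
... | false = trans (pairCount-filter Rb p xs) (cong (_+ pairCount (λ a b → p a ∧ (p b ∧ Rb a b)) xs) (sym (Σ-zero xs)))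

pairCount-increasing : ∀ Rb xs → Increasing xs → pairCount Rb xs ≡ ΣΣ (λ a b → (a <ᵇ b) ∧ Rb a b) xs
pairCount-increasing Rb [] _ = refl
pairCount-increasing Rb (x ∷ xs) (x< ∷ inc) = sym (begin
  ΣΣ (λ a b → (a <ᵇ b) ∧ Rb a b) (x ∷ xs)
    ≡⟨ cong₂ _+_ (cong (λ c → ⟦ c ∧ Rb x x ⟧ + Σ (λ b → ⟦ (x <ᵇ b) ∧ Rb x b ⟧) xs) (<ᵇ-false {x} {x} (<-irrefl refl)))
                 (Σ-cong xs λ {a} a∈ → cong (λ c → ⟦ c ∧ Rb a x ⟧ + Σ (λ b → ⟦ (a <ᵇ b) ∧ Rb a b ⟧) xs)
                                            (<ᵇ-false (<-asym (lookup x< a∈)))) ⟩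
  Σ (λ b → ⟦ (x <ᵇ b) ∧ Rb x b ⟧) xs + ΣΣ (λ a b → (a <ᵇ b) ∧ Rb a b) xs
    ≡⟨ cong₂ _+_ (Σ-cong xs λ {y} y∈ → cong (λ c → ⟦ c ∧ Rb x y ⟧) (<ᵇ-true (lookup x< y∈)))
                 (sym (pairCount-increasing Rb xs inc)) ⟩
  pairCount Rb (x ∷ xs) ∎)
  where open ≡-Reasoning

⟦≤ᵇ⟧-split : ∀ t a b → ⟦ t ≤ᵇ a ⟧ ≡ ⟦ (b <ᵇ t) ∧ (t ≤ᵇ a) ⟧ + ⟦ (t ≤ᵇ a) ∧ (t ≤ᵇ b) ⟧
⟦≤ᵇ⟧-split t a b with t ≤? a | t ≤? b
... | yes t≤a | yes t≤b rewrite ≤ᵇ-true t≤a | ≤ᵇ-true t≤b | <ᵇ-false {b} {t} (≤⇒≯ t≤b) = refl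
... | yes t≤a | no t≰b rewrite ≤ᵇ-true t≤a | ≤ᵇ-false t≰b | <ᵇ-true {b} {t} (≰⇒> t≰b) = refl
... | no t≰a | _ rewrite ≤ᵇ-false t≰a | ∧-zeroʳ (b <ᵇ t) = refl

-- With v = π_η and w the word of σ, reindexing N^±_σ by k = σ(i) yields PlusPair and
-- MinusPair, while ExcPair and NonExcPair are the pairs counted by imv(E(w)) and inv(N(w)).
module PairCounts (n : ℕ) (v w : ℕ → ℕ)
  (v-mono : ∀ {i j} → i ≤ j → v i ≤ v j)
  (balanced : ∀ t → Σ (λ j → ⟦ t ≤ᵇ w j ⟧) (range n) ≡ Σ (λ j → ⟦ t ≤ᵇ v j ⟧) (range n)) where

  R : List ℕ
  R = range n

  Exc : ℕ → Bool
  Exc k = v k <ᵇ w k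

  PlusPair MinusPair ExcPair NonExcPair : ℕ → ℕ → Bool
  PlusPair k j = (k <ᵇ j) ∧ ((w j <ᵇ w k) ∧ (w k ≤ᵇ v j))
  MinusPair k j = (k <ᵇ j) ∧ ((v j <ᵇ w k) ∧ (w k ≤ᵇ w j))
  ExcPair a b = (a <ᵇ b) ∧ ((Exc a ∧ Exc b) ∧ (w b ≤ᵇ w a))
  NonExcPair a b = (a <ᵇ b) ∧ ((not (Exc a) ∧ not (Exc b)) ∧ (w b <ᵇ w a))

  CrossesUp CrossesDown : ℕ → ℕ → Bool
  CrossesUp t j = (v j <ᵇ t) ∧ (t ≤ᵇ w j)
  CrossesDown t j = (w j <ᵇ t) ∧ (t ≤ᵇ v j)

  up-crossings≡down-crossings : ∀ t → Σ (λ j → ⟦ CrossesUp t j ⟧) R ≡ Σ (λ j → ⟦ CrossesDown t j ⟧) R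
  up-crossings≡down-crossings t = +-cancelʳ-≡ _ _ _ (begin
    Σ (λ j → ⟦ CrossesUp t j ⟧) R + Σ both R    ≡⟨ Σ-+ _ both R ⟨
    Σ (λ j → ⟦ CrossesUp t j ⟧ + both j) R      ≡⟨ Σ-cong R (λ {j} _ → ⟦≤ᵇ⟧-split t (w j) (v j)) ⟨
    Σ (λ j → ⟦ t ≤ᵇ w j ⟧) R                    ≡⟨ balanced t ⟩
    Σ (λ j → ⟦ t ≤ᵇ v j ⟧) R                    ≡⟨ Σ-cong R (λ {j} _ → ⟦≤ᵇ⟧-split-comm j) ⟩
    Σ (λ j → ⟦ CrossesDown t j ⟧ + both j) R    ≡⟨ Σ-+ _ both R ⟩
    Σ (λ j → ⟦ CrossesDown t j ⟧) R + Σ both R  ∎)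
    where
    open ≡-Reasoning
    both : ℕ → ℕ
    both j = ⟦ (t ≤ᵇ w j) ∧ (t ≤ᵇ v j) ⟧
    ⟦≤ᵇ⟧-split-comm : ∀ j → ⟦ t ≤ᵇ v j ⟧ ≡ ⟦ CrossesDown t j ⟧ + both j
    ⟦≤ᵇ⟧-split-comm j = trans (⟦≤ᵇ⟧-split t (v j) (w j)) (cong (λ b → ⟦ CrossesDown t j ⟧ + ⟦ b ⟧) (∧-comm (t ≤ᵇ v j) (t ≤ᵇ w j)))

  module _ (k : ℕ) where

    wk≤vj : w k ≤ v k → ∀ {j} → k < j → w k ≤ v j
    wk≤vj wk≤vk k<j = ≤-trans wk≤vk (v-mono (<⇒≤ k<j))

    minus-row-zero : w k ≤ v k → ∀ j → ⟦ MinusPair k j ⟧ ≡ 0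
    minus-row-zero wk≤vk j with k <? j
    ... | no k≮j rewrite <ᵇ-false k≮j = refl
    ... | yes k<j rewrite <ᵇ-true k<j | <ᵇ-false (≤⇒≯ (wk≤vj wk≤vk k<j)) = refl

    exc-column-zero : w k ≤ v k → ∀ j → ⟦ ExcPair j k ⟧ ≡ 0
    exc-column-zero wk≤vk j rewrite <ᵇ-false {v k} {w k} (≤⇒≯ wk≤vk) | ∧-zeroʳ (Exc j) | ∧-zeroʳ (j <ᵇ k) = refl

    plus≡nonExc : w k ≤ v k → ∀ j → ⟦ PlusPair k j ⟧ ≡ ⟦ NonExcPair k j ⟧
    plus≡nonExc wk≤vk j rewrite <ᵇ-false {v k} {w k} (≤⇒≯ wk≤vk) with k <? j
    ... | no k≮j rewrite <ᵇ-false k≮j = refl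
    ... | yes k<j rewrite <ᵇ-true k<j with w j <? w k
    ...   | no wj≮wk rewrite <ᵇ-false wj≮wk | ∧-zeroʳ (not (Exc j)) = refl
    ...   | yes wj<wk rewrite <ᵇ-true wj<wk | ≤ᵇ-true (wk≤vj wk≤vk k<j) | <ᵇ-false (<⇒≯ (<-≤-trans wj<wk (wk≤vj wk≤vk k<j))) = refl

    nonExc-row-zero : v k < w k → ∀ j → ⟦ NonExcPair k j ⟧ ≡ 0
    nonExc-row-zero vk<wk j rewrite <ᵇ-true vk<wk | ∧-zeroʳ (k <ᵇ j) = refl

    plus≡crossesDown : v k < w k → ∀ j → ⟦ PlusPair k j ⟧ ≡ ⟦ CrossesDown (w k) j ⟧
    plus≡crossesDown vk<wk j with k <? j
    ... | yes k<j rewrite <ᵇ-true k<j = refl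
    ... | no k≮j rewrite <ᵇ-false k≮j with w k ≤? v j
    ...   | yes wk≤vj = contradiction (≤-trans wk≤vj (v-mono (≮⇒≥ k≮j))) (<⇒≱ vk<wk)
    ...   | no wk≰vj rewrite ≤ᵇ-false wk≰vj | ∧-zeroʳ (w j <ᵇ w k) = refl

    vj<wk : v k < w k → ∀ {j} → j < k → v j < w k
    vj<wk vk<wk j<k = ≤-<-trans (v-mono (<⇒≤ j<k)) vk<wk

    crossesUp-split : v k < w k → ∀ j → ⟦ CrossesUp (w k) j ⟧ ≡ ⟦ MinusPair k j ⟧ + ⟦ j ≡ᵇ k ⟧ + ⟦ ExcPair j k ⟧
    crossesUp-split vk<wk j rewrite <ᵇ-true vk<wk | ∧-identityʳ (Exc j) with <-cmp k j
    ... | tri< k<j _ j≯k rewrite <ᵇ-true k<j | <ᵇ-false j≯k | ≡ᵇ-false {j} {k} (<⇒≢ k<j ∘ sym) =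
      sym (trans (+-identityʳ _) (+-identityʳ _))
    ... | tri≈ _ refl _ rewrite <ᵇ-false {k} {k} (<-irrefl refl) | ≡ᵇ-true {k} {k} refl | <ᵇ-true vk<wk | ≤ᵇ-true (≤-refl {w k}) = refl
    ... | tri> _ _ j<k rewrite <ᵇ-true j<k | <ᵇ-false {k} {j} (<-asym j<k) | ≡ᵇ-false {j} {k} (<⇒≢ j<k)
                             | <ᵇ-true (vj<wk vk<wk j<k) with w k ≤? w j
    ...   | yes wk≤wj rewrite ≤ᵇ-true wk≤wj | <ᵇ-true (<-≤-trans (vj<wk vk<wk j<k) wk≤wj) = refl
    ...   | no wk≰wj rewrite ≤ᵇ-false wk≰wj | ∧-zeroʳ (Exc j) = refl

    plusRow minusRow excColumn nonExcRow : ℕ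
    plusRow = Σ (λ j → ⟦ PlusPair k j ⟧) R
    minusRow = Σ (λ j → ⟦ MinusPair k j ⟧) R
    excColumn = Σ (λ j → ⟦ ExcPair j k ⟧) R
    nonExcRow = Σ (λ j → ⟦ NonExcPair k j ⟧) R

    -- For an excedance k, plusRow counts the downward crossings of the level w k; as w is a
    -- rearrangement of v there are as many upward crossings, and these are the MinusPair row,
    -- k itself, and the ExcPair column.
    row-identity : k ∈ R → plusRow ≡ minusRow + ⟦ Exc k ⟧ + excColumn + nonExcRow
    row-identity k∈ with v k <? w k
    ... | no vk≮wk = begin
      plusRow                                      ≡⟨ Σ-cong R (λ {j} _ → plus≡nonExc wk≤vk j) ⟩
      nonExcRow                                    ≡⟨ other-terms-vanish ⟨
      minusRow + ⟦ Exc k ⟧ + excColumn + nonExcRow ∎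
      where
      open ≡-Reasoning
      wk≤vk = ≮⇒≥ vk≮wk
      other-terms-vanish : minusRow + ⟦ Exc k ⟧ + excColumn + nonExcRow ≡ nonExcRow
      other-terms-vanish
        rewrite Σ-cong R (λ {j} _ → minus-row-zero wk≤vk j) | Σ-zero R
              | Σ-cong R (λ {j} _ → exc-column-zero wk≤vk j) | Σ-zero R | <ᵇ-false vk≮wk = refl
    ... | yes vk<wk = begin
      plusRow                                                          ≡⟨ Σ-cong R (λ {j} _ → plus≡crossesDown vk<wk j) ⟩
      Σ (λ j → ⟦ CrossesDown (w k) j ⟧) R                              ≡⟨ up-crossings≡down-crossings (w k) ⟨
      Σ (λ j → ⟦ CrossesUp (w k) j ⟧) R                                ≡⟨ Σ-cong R (λ {j} _ → crossesUp-split vk<wk j) ⟩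
      Σ (λ j → ⟦ MinusPair k j ⟧ + ⟦ j ≡ᵇ k ⟧ + ⟦ ExcPair j k ⟧) R      ≡⟨ Σ-+ _ _ R ⟩
      Σ (λ j → ⟦ MinusPair k j ⟧ + ⟦ j ≡ᵇ k ⟧) R + excColumn          ≡⟨ cong (_+ excColumn) (Σ-+ _ _ R) ⟩
      minusRow + Σ (λ j → ⟦ j ≡ᵇ k ⟧) R + excColumn                  ≡⟨ cong (λ c → minusRow + c + excColumn) (Σ-range-⟦≡ᵇ⟧ n k (∈-range⁻ k∈)) ⟩
      minusRow + 1 + excColumn                                       ≡⟨ cong (λ b → minusRow + ⟦ b ⟧ + excColumn) (<ᵇ-true vk<wk) ⟨
      minusRow + ⟦ Exc k ⟧ + excColumn                               ≡⟨ +-identityʳ _ ⟨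
      minusRow + ⟦ Exc k ⟧ + excColumn + 0                           ≡⟨ cong (_+_ (minusRow + ⟦ Exc k ⟧ + excColumn)) nonExcRow≡0 ⟨
      minusRow + ⟦ Exc k ⟧ + excColumn + nonExcRow                   ∎
      where
      open ≡-Reasoning
      nonExcRow≡0 = trans (Σ-cong R (λ {j} _ → nonExc-row-zero vk<wk j)) (Σ-zero R)

  pair-identity : ΣΣ PlusPair R ≡ ΣΣ MinusPair R + Σ (⟦_⟧ ∘ Exc) R + ΣΣ ExcPair R + ΣΣ NonExcPair R
  pair-identity = begin
    ΣΣ PlusPair R
      ≡⟨ Σ-cong R (λ {k} k∈ → row-identity k k∈) ⟩
    Σ (λ k → minusRow k + ⟦ Exc k ⟧ + excColumn k + nonExcRow k) R
      ≡⟨ Σ-+ _ _ R ⟩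
    Σ (λ k → minusRow k + ⟦ Exc k ⟧ + excColumn k) R + ΣΣ NonExcPair R
      ≡⟨ cong (_+ ΣΣ NonExcPair R) (Σ-+ _ _ R) ⟩
    Σ (λ k → minusRow k + ⟦ Exc k ⟧) R + Σ excColumn R + ΣΣ NonExcPair R
      ≡⟨ cong (λ c → c + Σ excColumn R + ΣΣ NonExcPair R) (Σ-+ _ _ R) ⟩
    ΣΣ MinusPair R + Σ (⟦_⟧ ∘ Exc) R + Σ excColumn R + ΣΣ NonExcPair R
      ≡⟨ cong (λ c → ΣΣ MinusPair R + Σ (⟦_⟧ ∘ Exc) R + c + ΣΣ NonExcPair R) (Σ-swap (λ k j → ⟦ ExcPair j k ⟧) R R) ⟩
    ΣΣ MinusPair R + Σ (⟦_⟧ ∘ Exc) R + ΣΣ ExcPair R + ΣΣ NonExcPair R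
      ∎
    where open ≡-Reasoning

Admissible : List ℕ → List ℕ → Set
Admissible η σ = ∀ {i j} → i ∈ range (nOf η) → j ∈ range (nOf η) → i < j → blk η i ≡ blk η j → at σ i < at σ j

toWord : List ℕ → List ℕ → List ℕ
toWord η σ = map (λ j → blk η (pos σ j)) (range (nOf η))

unique-resp-↭ : {xs ys : List ℕ} → xs ↭ ys → Unique xs → Unique ys
unique-resp-↭ p = ↭ₛ.Unique-resp-↭ (setoid ℕ) (↭⇒↭ₛ p)

admissible-sound : ∀ η σ → T (isAdmissible η σ) → Admissible η σ
admissible-sound η σ t {i} {j} i∈ j∈ i<j same = checked (lookup (all⁺ _ (pairs (nOf η)) t) (∈-pairs⁺ i∈ j∈))
  where
  checked : T (if (i <ᵇ j) ∧ (blk η i ≡ᵇ blk η j) then at σ i <ᵇ at σ j else true) → at σ i < at σ j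
  checked t rewrite <ᵇ-true i<j | ≡ᵇ-true same = <ᵇ⇒< _ _ t

admissible-complete : ∀ η σ → Admissible η σ → T (isAdmissible η σ)
admissible-complete η σ adm = all⁻ _ (tabulate λ {ij} ij∈ → checked ij (∈-pairs⁻ ij∈))
  where
  checked : ∀ ij → proj₁ ij ∈ range (nOf η) × proj₂ ij ∈ range (nOf η) →
    T (if (proj₁ ij <ᵇ proj₂ ij) ∧ (blk η (proj₁ ij) ≡ᵇ blk η (proj₂ ij)) then at σ (proj₁ ij) <ᵇ at σ (proj₂ ij) else true)
  checked (i , j) (i∈ , j∈) with i <? j | blk η i ≟ blk η j
  ... | no i≮j | _ rewrite <ᵇ-false i≮j = tt
  ... | yes i<j | no diff rewrite <ᵇ-true i<j | ≡ᵇ-false diff = tt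
  ... | yes i<j | yes same rewrite <ᵇ-true i<j | ≡ᵇ-true same = <⇒<ᵇ (adm i∈ j∈ i<j same)

∈-Sup⁻ : ∀ η {σ} → σ ∈ Sup η → σ ↭ range (nOf η) × Admissible η σ
∈-Sup⁻ η {σ} σ∈ with ∈-filter⁻ (T? ∘ isAdmissible η) {xs = Sn (nOf η)} σ∈
... | σ∈Sn , adm with ∈-filter⁻ (λ s → T? (isRearr s (range (nOf η)))) {xs = words (nOf η) (nOf η)} σ∈Sn
...   | _ , rearr = isRearr-sound σ _ rearr , admissible-sound η σ adm

∈-Sup⁺ : ∀ η {σ} → σ ↭ range (nOf η) → Admissible η σ → σ ∈ Sup η
∈-Sup⁺ η {σ} σ↭ adm =
  ∈-filter⁺ (T? ∘ isAdmissible η)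
    (∈-filter⁺ (λ s → T? (isRearr s (range n))) (∈-words⁺ n n σ length≡ in-range) (isRearr-complete σ _ σ↭))
    (admissible-complete η σ adm)
  where
  n = nOf η
  length≡ = trans (↭-length σ↭) (length-range n)
  in-range = tabulate (∈-range⁻ ∘ ∈-resp-↭ σ↭)

∈-Sη⁻ : ∀ η {w} → w ∈ Sη η → length w ≡ nOf η × All (InRange (length η)) w × w ↭ idWord η
∈-Sη⁻ η {w} w∈ with ∈-filter⁻ (λ u → T? (isRearr u (idWord η))) {xs = words (nOf η) (length η)} w∈
... | w∈words , rearr with ∈-words⁻ _ _ w w∈words
...   | length≡ , in-range = length≡ , in-range , isRearr-sound w _ rearr

∈-Sη⁺ : ∀ η {w} → length w ≡ nOf η → All (InRange (length η)) w → w ↭ idWord η → w ∈ Sη η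
∈-Sη⁺ η {w} length≡ in-range w↭ =
  ∈-filter⁺ (λ u → T? (isRearr u (idWord η))) (∈-words⁺ _ _ w length≡ in-range) (isRearr-complete w _ w↭)

module OfPermutation (η σ : List ℕ) (σ↭ : σ ↭ range (nOf η)) (admissible : Admissible η σ) where

  n : ℕ
  n = nOf η

  R : List ℕ
  R = range n

  w : List ℕ
  w = toWord η σ

  letter : ℕ → ℕ
  letter j = blk η (pos σ j)

  length-σ : length σ ≡ n
  length-σ = trans (↭-length σ↭) (length-range n)

  InRange-σ : ∀ {i} → i ∈ R → InRange (length σ) i
  InRange-σ {i} i∈ = proj₁ (∈-range⁻ i∈) , subst (i ≤_) (sym length-σ) (proj₂ (∈-range⁻ i∈))

  pos-∈ : ∀ {j} → j ∈ R → pos σ j ∈ R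
  pos-∈ {j} j∈ with pos-spec σ (∈-resp-↭ (↭-sym σ↭) j∈)
  ... | (1≤pos , pos≤) , _ = ∈-range⁺ (1≤pos , subst (pos σ j ≤_) length-σ pos≤)

  at-pos : ∀ {j} → j ∈ R → at σ (pos σ j) ≡ j
  at-pos j∈ = proj₂ (pos-spec σ (∈-resp-↭ (↭-sym σ↭) j∈))

  at-∈R : ∀ {i} → i ∈ R → at σ i ∈ R
  at-∈R i∈ = ∈-resp-↭ σ↭ (at-∈ σ _ (InRange-σ i∈))

  pos-at-σ : ∀ {i} → i ∈ R → pos σ (at σ i) ≡ i
  pos-at-σ i∈ = pos-at σ (unique-resp-↭ (↭-sym σ↭) (range-unique n)) _ (InRange-σ i∈)

  pos-injective : ∀ {k j} → k ∈ R → j ∈ R → pos σ k ≡ pos σ j → k ≡ j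
  pos-injective k∈ j∈ eq = trans (sym (at-pos k∈)) (trans (cong (at σ) eq) (at-pos j∈))

  Σ-reindex : (F : ℕ → ℕ) → Σ F R ≡ Σ (F ∘ pos σ) R
  Σ-reindex F = sym (begin
    Σ (F ∘ pos σ) R                                      ≡⟨ Σ-↭ (F ∘ pos σ) (↭-sym σ↭) ⟩
    Σ (F ∘ pos σ) σ                                      ≡⟨ cong (Σ (F ∘ pos σ)) (map-at-range σ) ⟨
    Σ (F ∘ pos σ) (map (at σ) (range (length σ)))        ≡⟨ Σ-map (F ∘ pos σ) (at σ) (range (length σ)) ⟩
    Σ (F ∘ pos σ ∘ at σ) (range (length σ))              ≡⟨ cong (λ m → Σ (F ∘ pos σ ∘ at σ) (range m)) length-σ ⟩
    Σ (F ∘ pos σ ∘ at σ) R                               ≡⟨ Σ-cong R (cong F ∘ pos-at-σ) ⟩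
    Σ F R                                                ∎)
    where open ≡-Reasoning

  letter<⇒pos< : ∀ {k j} → letter j < letter k → pos σ j < pos σ k
  letter<⇒pos< {k} {j} lt with pos σ j <? pos σ k
  ... | yes p = p
  ... | no p = contradiction (blk-mono η (≮⇒≥ p)) (<⇒≱ lt)

  pos<⇒letter< : ∀ {k j} → k ∈ R → j ∈ R → k < j → pos σ j < pos σ k → letter j < letter k
  pos<⇒letter< {k} {j} k∈ j∈ k<j lt = ≤∧≢⇒< (blk-mono η (<⇒≤ lt)) same-block⇒⊥
    where
    same-block⇒⊥ : letter j ≢ letter k
    same-block⇒⊥ eq = <-asym k<j (subst₂ _<_ (at-pos j∈) (at-pos k∈) (admissible (pos-∈ j∈) (pos-∈ k∈) lt eq))

  open PairCounts n (blk η) letter (blk-mono η) (λ t → sym (Σ-reindex (λ j → ⟦ t ≤ᵇ blk η j ⟧))) hiding (R)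

  map-pos↭ : map (pos σ) R ↭ R
  map-pos↭ = ↭-trans (map⁺ (pos σ) (↭-sym σ↭)) (↭-reflexive (begin
    map (pos σ) σ                                 ≡⟨ cong (map (pos σ)) (map-at-range σ) ⟨
    map (pos σ) (map (at σ) (range (length σ)))   ≡⟨ List.map-∘ (range (length σ)) ⟨
    map (pos σ ∘ at σ) (range (length σ))         ≡⟨ cong (λ m → map (pos σ ∘ at σ) (range m)) length-σ ⟩
    map (pos σ ∘ at σ) R                          ≡⟨ List.map-cong-local (tabulate pos-at-σ) ⟩
    map (λ i → i) R                               ≡⟨ List.map-id R ⟩
    R                                             ∎))
    where open ≡-Reasoning

  w↭idWord : w ↭ idWord η
  w↭idWord = ↭-trans (↭-reflexive (List.map-∘ R))
                     (↭-trans (map⁺ (blk η) map-pos↭) (↭-reflexive (sym (idWord≡map-blk η))))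

  w-InRange : All (InRange (length η)) w
  w-InRange = tabulate λ l∈ → let j , j∈ , l≡ = ∈-map⁻ letter l∈ in
    subst (InRange (length η)) (sym l≡) (blk-InRange η (∈-range⁻ (pos-∈ j∈)))

  Nplus≡ : Nplus η σ ≡ ΣΣ PlusPair R
  Nplus≡ = begin
    Nplus η σ
      ≡⟨ countB-pairs _ n ⟩
    ΣΣ (λ i j → (blk η i ≤ᵇ blk η j) ∧ ((at σ i <ᵇ j) ∧ (pos σ j <ᵇ i))) R
      ≡⟨ Σ-reindex _ ⟩
    ΣΣ (λ k j → (letter k ≤ᵇ blk η j) ∧ ((at σ (pos σ k) <ᵇ j) ∧ (pos σ j <ᵇ pos σ k))) R
      ≡⟨ Σ-cong R (λ k∈ → Σ-cong R (λ j∈ → cong ⟦_⟧ (pointwise k∈ j∈))) ⟩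
    ΣΣ PlusPair R
      ∎
    where
    open ≡-Reasoning
    pointwise : ∀ {k j} → k ∈ R → j ∈ R →
      (letter k ≤ᵇ blk η j) ∧ ((at σ (pos σ k) <ᵇ j) ∧ (pos σ j <ᵇ pos σ k)) ≡ PlusPair k j
    pointwise {k} {j} k∈ j∈ rewrite at-pos k∈ with k <? j
    ... | no k≮j rewrite <ᵇ-false k≮j | ∧-zeroʳ (letter k ≤ᵇ blk η j) = refl
    ... | yes k<j rewrite <ᵇ-true k<j with letter j <? letter k
    ...   | yes lt rewrite <ᵇ-true lt | <ᵇ-true (letter<⇒pos< lt) | ∧-identityʳ (letter k ≤ᵇ blk η j) = refl
    ...   | no lj≮lk rewrite <ᵇ-false lj≮lk | <ᵇ-false (lj≮lk ∘ pos<⇒letter< k∈ j∈ k<j) | ∧-zeroʳ (letter k ≤ᵇ blk η j) = refl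

  Nminus≡ : Nminus η σ ≡ ΣΣ MinusPair R
  Nminus≡ = begin
    Nminus η σ
      ≡⟨ countB-pairs _ n ⟩
    ΣΣ (λ i j → (blk η j <ᵇ blk η i) ∧ ((at σ i <ᵇ j) ∧ (i <ᵇ pos σ j))) R
      ≡⟨ Σ-reindex _ ⟩
    ΣΣ (λ k j → (blk η j <ᵇ letter k) ∧ ((at σ (pos σ k) <ᵇ j) ∧ (pos σ k <ᵇ pos σ j))) R
      ≡⟨ Σ-cong R (λ k∈ → Σ-cong R (λ j∈ → cong ⟦_⟧ (pointwise k∈ j∈))) ⟩
    ΣΣ MinusPair R
      ∎
    where
    open ≡-Reasoning
    pointwise : ∀ {k j} → k ∈ R → j ∈ R →
      (blk η j <ᵇ letter k) ∧ ((at σ (pos σ k) <ᵇ j) ∧ (pos σ k <ᵇ pos σ j)) ≡ MinusPair k j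
    pointwise {k} {j} k∈ j∈ rewrite at-pos k∈ with k <? j
    ... | no k≮j rewrite <ᵇ-false k≮j | ∧-zeroʳ (blk η j <ᵇ letter k) = refl
    ... | yes k<j rewrite <ᵇ-true k<j with letter k ≤? letter j
    ...   | yes lk≤lj rewrite ≤ᵇ-true lk≤lj
                            | <ᵇ-true (≤∧≢⇒< (≮⇒≥ λ lt → <⇒≱ (pos<⇒letter< k∈ j∈ k<j lt) lk≤lj) (<⇒≢ k<j ∘ pos-injective k∈ j∈)) = refl
    ...   | no lk≰lj rewrite ≤ᵇ-false lk≰lj | <ᵇ-false (<⇒≱ (letter<⇒pos< (≰⇒> lk≰lj)) ∘ <⇒≤) = refl

  length-w : length w ≡ n
  length-w = trans (List.length-map letter R) (length-range n)

  at-w : ∀ {j} → j ∈ R → at w j ≡ letter j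
  at-w {j} j∈ = trans (at-map letter R j (proj₁ (∈-range⁻ j∈) , subst (j ≤_) (sym (length-range n)) (proj₂ (∈-range⁻ j∈))))
                      (cong letter (at-range n j (∈-range⁻ j∈)))

  isExc≡Exc : ∀ {j} → j ∈ R → isExc η w j ≡ Exc j
  isExc≡Exc j∈ = cong₂ _<ᵇ_ (at-idWord η _ (∈-range⁻ j∈)) (at-w j∈)

  exc≡iexc : exc η w ≡ iexc η σ
  exc≡iexc = trans (countB≡Σ _ R) (trans (Σ-cong R (cong ⟦_⟧ ∘ isExc≡Exc)) (sym (countB≡Σ _ R)))

  excSum≡ : sumB (isExc η w) R ≡ sumB (inI η σ) R
  excSum≡ = trans (sumB≡Σ _ R) (trans (Σ-cong R λ {j} j∈ → cong (λ b → if b then j else 0) (isExc≡Exc j∈)) (sym (sumB≡Σ _ R)))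

  subword-pairCount : (p : ℕ → Bool) (Rb : ℕ → ℕ → Bool) →
    countB (λ ij → (proj₁ ij <ᵇ proj₂ ij) ∧ Rb (at (subword p w) (proj₁ ij)) (at (subword p w) (proj₂ ij)))
           (pairs (length (subword p w)))
      ≡ ΣΣ (λ a b → (a <ᵇ b) ∧ (p a ∧ (p b ∧ Rb (at w a) (at w b)))) R
  subword-pairCount p Rb = begin
    _ ≡⟨ countB-pairs _ (length u) ⟩
    ΣΣ (λ i j → (i <ᵇ j) ∧ Rb (at u i) (at u j)) (range (length u))        ≡⟨ positionalPairCount≡pairCount Rb u ⟩
    pairCount Rb (map (at w) (filter (T? ∘ p) (range (length w))))           ≡⟨ pairCount-map Rb (at w) (filter (T? ∘ p) (range (length w))) ⟩
    pairCount Rb′ (filter (T? ∘ p) (range (length w)))                      ≡⟨ pairCount-filter Rb′ p (range (length w)) ⟩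
    pairCount both (range (length w))                                       ≡⟨ cong (λ m → pairCount both (range m)) length-w ⟩
    pairCount both R                                                        ≡⟨ pairCount-increasing both R (range-increasing n) ⟩
    ΣΣ (λ a b → (a <ᵇ b) ∧ both a b) R                                      ∎
    where
    open ≡-Reasoning
    u = subword p w
    Rb′ both : ℕ → ℕ → Bool
    Rb′ a b = Rb (at w a) (at w b)
    both a b = p a ∧ (p b ∧ Rb′ a b)

  imv≡ : imv (Eword η w) ≡ ΣΣ ExcPair R
  imv≡ = trans (subword-pairCount (isExc η w) (λ a b → b ≤ᵇ a))
    (Σ-cong R λ {a} a∈ → Σ-cong R λ {b} b∈ → cong (λ c → ⟦ (a <ᵇ b) ∧ c ⟧) (begin
      isExc η w a ∧ (isExc η w b ∧ (at w b ≤ᵇ at w a))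
        ≡⟨ cong₂ (λ x y → x ∧ (y ∧ (at w b ≤ᵇ at w a))) (isExc≡Exc a∈) (isExc≡Exc b∈) ⟩
      Exc a ∧ (Exc b ∧ (at w b ≤ᵇ at w a))
        ≡⟨ cong₂ (λ x y → Exc a ∧ (Exc b ∧ (x ≤ᵇ y))) (at-w b∈) (at-w a∈) ⟩
      Exc a ∧ (Exc b ∧ (letter b ≤ᵇ letter a))
        ≡⟨ ∧-assoc (Exc a) (Exc b) _ ⟨
      (Exc a ∧ Exc b) ∧ (letter b ≤ᵇ letter a)
        ∎))
    where open ≡-Reasoning

  inv≡ : inv (Nword η w) ≡ ΣΣ NonExcPair R
  inv≡ = trans (subword-pairCount (λ i → if isExc η w i then false else true) (λ a b → b <ᵇ a))
    (Σ-cong R λ {a} a∈ → Σ-cong R λ {b} b∈ → cong (λ c → ⟦ (a <ᵇ b) ∧ c ⟧) (begin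
      nonExc a ∧ (nonExc b ∧ (at w b <ᵇ at w a))
        ≡⟨ cong₂ (λ x y → x ∧ (y ∧ (at w b <ᵇ at w a))) (nonExc≡ a∈) (nonExc≡ b∈) ⟩
      not (Exc a) ∧ (not (Exc b) ∧ (at w b <ᵇ at w a))
        ≡⟨ cong₂ (λ x y → not (Exc a) ∧ (not (Exc b) ∧ (x <ᵇ y))) (at-w b∈) (at-w a∈) ⟩
      not (Exc a) ∧ (not (Exc b) ∧ (letter b <ᵇ letter a))
        ≡⟨ ∧-assoc (not (Exc a)) (not (Exc b)) _ ⟨
      (not (Exc a) ∧ not (Exc b)) ∧ (letter b <ᵇ letter a)
        ∎))
    where
    open ≡-Reasoning
    nonExc : ℕ → Bool
    nonExc i = if isExc η w i then false else true
    if-not : ∀ c → (if c then false else true) ≡ not c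
    if-not true = refl
    if-not false = refl
    nonExc≡ : ∀ {i} → i ∈ R → nonExc i ≡ not (Exc i)
    nonExc≡ i∈ = trans (if-not _) (cong not (isExc≡Exc i∈))

  Nplus-decomposition : Nplus η σ ≡ Nminus η σ + iexc η σ + imv (Eword η w) + inv (Nword η w)
  Nplus-decomposition = begin
    Nplus η σ                                                      ≡⟨ Nplus≡ ⟩
    ΣΣ PlusPair R                                                  ≡⟨ pair-identity ⟩
    ΣΣ MinusPair R + Σ (⟦_⟧ ∘ Exc) R + ΣΣ ExcPair R + ΣΣ NonExcPair R
      ≡⟨ cong₂ _+_ (cong₂ _+_ (cong₂ _+_ Nminus≡ (countB≡Σ _ R)) imv≡) inv≡ ⟨
    Nminus η σ + iexc η σ + imv (Eword η w) + inv (Nword η w)      ∎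
    where open ≡-Reasoning

  den≡denH : den η σ ≡ + denH η w
  den≡denH = begin
    den η σ                       ≡⟨ ℤ.m-n≡m⊖n (S + Nplus η σ) M ⟩
    (S + Nplus η σ) ⊖ M           ≡⟨ cong₂ _⊖_ (trans (cong (_+_ S) Nplus-decomposition) (regroup S M E N)) (sym (+-identityʳ M)) ⟩
    (M + (S + E + N)) ⊖ (M + 0)   ≡⟨ ℤ.+-cancelˡ-⊖ M (S + E + N) 0 ⟩
    + (S + E + N)                 ≡⟨ cong (λ s → + (s + E + N)) excSum≡ ⟨
    + denH η w                    ∎
    where
    open ≡-Reasoning
    open +-*-Solver
    S = sumB (inI η σ) R
    M = Nminus η σ + iexc η σ
    E = imv (Eword η w)
    N = inv (Nword η w)
    regroup : ∀ s m i j → s + (m + i + j) ≡ m + (s + i + j)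
    regroup = solve 4 (λ s m i j → s :+ (m :+ i :+ j) := m :+ (s :+ i :+ j)) refl

  w∈Sη : w ∈ Sη η
  w∈Sη = ∈-Sη⁺ η length-w w-InRange w↭idWord

  statistics : (den η σ , iexc η σ) ≡ (+ denH η w , exc η w)
  statistics = cong₂ _,_ den≡denH (sym exc≡iexc)

record Segment (L : List ℕ) (F G : ℕ → List ℕ) (p : ℕ) : Set where
  field
    label : ℕ
    offset : ℕ
    offset∈ : InRange (length (F label)) offset
    at-F : at (concatMap F L) p ≡ at (F label) offset
    at-G : at (concatMap G L) p ≡ at (G label) offset

segment : (L : List ℕ) (F G : ℕ → List ℕ) → (∀ {a} → a ∈ L → length (F a) ≡ length (G a)) →
  ∀ p → InRange (length (concatMap F L)) p → Segment L F G p
segment [] F G _ (suc p) (_ , ())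
segment (a ∷ L) F G same-length p (1≤p , p≤) with p ≤? length (F a)
... | yes p≤|Fa| = record
  { label = a ; offset = p ; offset∈ = 1≤p , p≤|Fa|
  ; at-F = at-++ˡ (F a) _ p (1≤p , p≤|Fa|)
  ; at-G = at-++ˡ (G a) _ p (1≤p , subst (p ≤_) (same-length (here refl)) p≤|Fa|) }
... | no p≰|Fa| = record
  { label = label ; offset = offset ; offset∈ = offset∈
  ; at-F = trans (cong (at (concatMap F (a ∷ L))) p≡) (trans (at-++ʳ (F a) _ d 1≤d) at-F)
  ; at-G = trans (cong (at (concatMap G (a ∷ L))) (trans p≡ (cong (_+ d) (same-length (here refl)))))
                 (trans (at-++ʳ (G a) _ d 1≤d) at-G) }
  where
  |Fa|<p = ≰⇒> p≰|Fa|
  d = p ∸ length (F a)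
  1≤d : 1 ≤ d
  1≤d = m<n⇒0<n∸m |Fa|<p
  p≡ : p ≡ length (F a) + d
  p≡ = sym (m+[n∸m]≡n (<⇒≤ |Fa|<p))
  d≤ : d ≤ length (concatMap F L)
  d≤ = +-cancelˡ-≤ (length (F a)) d _ (subst₂ _≤_ p≡ (List.length-++ (F a)) p≤)
  open Segment (segment L F G (λ a∈ → same-length (there a∈)) d (1≤d , d≤))

module Inverse (η : List ℕ) where

  n r : ℕ
  n = nOf η
  r = length η

  R Rr : List ℕ
  R = range n
  Rr = range r

  positions : List ℕ → ℕ → List ℕ
  positions w a = filter (λ j → T? (at w j ≡ᵇ a)) R

  block : ℕ → List ℕ
  block a = filter (λ j → T? (blk η j ≡ᵇ a)) R

  toPerm : List ℕ → List ℕ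
  toPerm w = concatMap (positions w) Rr

  ∈-positions⁻ : ∀ {w a j} → j ∈ positions w a → j ∈ R × at w j ≡ a
  ∈-positions⁻ {w} {a} j∈ with ∈-filter⁻ (λ j → T? (at w j ≡ᵇ a)) {xs = R} j∈
  ... | j∈R , t = j∈R , ≡ᵇ⇒≡ _ _ t

  ∈-positions⁺ : ∀ {w a j} → j ∈ R → at w j ≡ a → j ∈ positions w a
  ∈-positions⁺ {w} {a} j∈ eq = ∈-filter⁺ (λ j → T? (at w j ≡ᵇ a)) j∈ (≡⇒≡ᵇ _ _ eq)

  ∈-block⁻ : ∀ {a j} → j ∈ block a → j ∈ R × blk η j ≡ a
  ∈-block⁻ {a} j∈ with ∈-filter⁻ (λ j → T? (blk η j ≡ᵇ a)) {xs = R} j∈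
  ... | j∈R , t = j∈R , ≡ᵇ⇒≡ _ _ t

  ∈-block⁺ : ∀ {a j} → j ∈ R → blk η j ≡ a → j ∈ block a
  ∈-block⁺ {a} j∈ eq = ∈-filter⁺ (λ j → T? (blk η j ≡ᵇ a)) j∈ (≡⇒≡ᵇ _ _ eq)

  block-increasing : ∀ a → Increasing (block a)
  block-increasing a = AllPairs.filter⁺ _ (range-increasing n)

  positions-increasing : ∀ w a → Increasing (positions w a)
  positions-increasing w a = AllPairs.filter⁺ _ (range-increasing n)

  concat-blocks : concatMap block Rr ≡ R
  concat-blocks = increasing-≡ _ _ (blocks-increasing Rr (range-increasing r)) (range-increasing n) (⊆ , ⊇)
    where
    blocks-increasing : (as : List ℕ) → Increasing as → Increasing (concatMap block as)
    blocks-increasing [] _ = []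
    blocks-increasing (a ∷ as) (a< ∷ inc) =
      AllPairs.++⁺ (block-increasing a) (blocks-increasing as inc) (tabulate λ x∈ → tabulate λ y∈ → earlier x∈ y∈)
      where
      earlier : ∀ {x y} → x ∈ block a → y ∈ concatMap block as → x < y
      earlier {x} {y} x∈ y∈ with find (∈-concatMap⁻ block {xs = as} y∈)
      ... | b , b∈ , y∈b = ≰⇒> λ y≤x →
        <⇒≱ (lookup a< b∈) (subst₂ _≤_ (proj₂ (∈-block⁻ y∈b)) (proj₂ (∈-block⁻ x∈)) (blk-mono η y≤x))
    ⊆ : ∀ {x} → x ∈ concatMap block Rr → x ∈ R
    ⊆ x∈ with find (∈-concatMap⁻ block {xs = Rr} x∈)
    ... | _ , _ , x∈a = proj₁ (∈-block⁻ x∈a)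
    ⊇ : ∀ {x} → x ∈ R → x ∈ concatMap block Rr
    ⊇ x∈ = ∈-concatMap⁺ block (lose (∈-range⁺ (blk-InRange η (∈-range⁻ x∈))) (∈-block⁺ x∈ refl))

  module OfWord (w : List ℕ) (length≡ : length w ≡ n) (in-range : All (InRange r) w) (w↭ : w ↭ idWord η) where

    map-at-w : map (at w) R ≡ w
    map-at-w = trans (cong (λ m → map (at w) (range m)) (sym length≡)) (map-at-range w)

    length-positions : ∀ a → length (positions w a) ≡ length (block a)
    length-positions a = begin
      length (positions w a)                    ≡⟨ length-filter≡Σ (λ j → at w j ≡ᵇ a) R ⟩
      Σ (λ j → ⟦ at w j ≡ᵇ a ⟧) R               ≡⟨ Σ-map count-a (at w) R ⟨
      Σ count-a (map (at w) R)                  ≡⟨ cong (Σ count-a) map-at-w ⟩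
      Σ count-a w                               ≡⟨ Σ-↭ count-a w↭ ⟩
      Σ count-a (idWord η)                      ≡⟨ cong (Σ count-a) (idWord≡map-blk η) ⟩
      Σ count-a (map (blk η) R)                 ≡⟨ Σ-map count-a (blk η) R ⟩
      Σ (λ j → ⟦ blk η j ≡ᵇ a ⟧) R              ≡⟨ length-filter≡Σ (λ j → blk η j ≡ᵇ a) R ⟨
      length (block a)                          ∎
      where
      open ≡-Reasoning
      count-a : ℕ → ℕ
      count-a x = ⟦ x ≡ᵇ a ⟧

    toPerm-unique : Unique (toPerm w)
    toPerm-unique = Unique.concat⁺ (tabulate positions-unique) (AllPairs.map⁺ (AllPairs.map disjoint (range-unique r)))
      where
      positions-unique : ∀ {xs} → xs ∈ map (positions w) Rr → Unique xs
      positions-unique xs∈ with ∈-map⁻ (positions w) xs∈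
      ... | _ , _ , refl = Unique.filter⁺ _ (range-unique n)
      disjoint : ∀ {a b} → a ≢ b → Disjoint (positions w a) (positions w b)
      disjoint a≢b (j∈a , j∈b) = a≢b (trans (sym (proj₂ (∈-positions⁻ {w} j∈a))) (proj₂ (∈-positions⁻ {w} j∈b)))

    toPerm↭ : toPerm w ↭ R
    toPerm↭ = unique-↭ toPerm-unique (range-unique n) (⊆ , ⊇)
      where
      ⊆ : ∀ {x} → x ∈ toPerm w → x ∈ R
      ⊆ x∈ with find (∈-concatMap⁻ (positions w) {xs = Rr} x∈)
      ... | _ , _ , x∈a = proj₁ (∈-positions⁻ {w} x∈a)
      ⊇ : ∀ {x} → x ∈ R → x ∈ toPerm w
      ⊇ {x} x∈ = ∈-concatMap⁺ (positions w) (lose (∈-range⁺ (lookup in-range (at-∈ w x x∈w))) (∈-positions⁺ {w} x∈ refl))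
        where
        x∈w : InRange (length w) x
        x∈w = proj₁ (∈-range⁻ x∈) , subst (x ≤_) (sym length≡) (proj₂ (∈-range⁻ x∈))

    length-toPerm : length (toPerm w) ≡ n
    length-toPerm = trans (↭-length toPerm↭) (length-range n)

    locate : ∀ {p} → p ∈ R → Segment Rr (positions w) block p
    locate {p} p∈ = segment Rr (positions w) block (λ {a} _ → length-positions a) p
      (proj₁ (∈-range⁻ p∈) , subst (p ≤_) (sym length-toPerm) (proj₂ (∈-range⁻ p∈)))

    module _ {p} (p∈ : p ∈ R) where
      open Segment (locate p∈)

      offset∈block : InRange (length (block label)) offset
      offset∈block = proj₁ offset∈ , subst (offset ≤_) (length-positions label) (proj₂ offset∈)

      at-block : at (block label) offset ≡ p
      at-block = trans (sym at-G) (trans (cong (λ xs → at xs p) concat-blocks) (at-range n p (∈-range⁻ p∈)))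

      blk≡label : blk η p ≡ label
      blk≡label = trans (cong (blk η) (sym at-block)) (proj₂ (∈-block⁻ (at-∈ _ _ offset∈block)))

    same-block-increasing : ∀ {a b k l} → a ≡ b →
      InRange (length (positions w a)) k → InRange (length (positions w b)) l →
      at (block a) k < at (block b) l → at (positions w a) k < at (positions w b) l
    same-block-increasing {a} refl k∈ l∈ lt =
      increasing-at (positions w a) (positions-increasing w a) _ _ (proj₁ k∈)
        (increasing-at⁻ (block a) (block-increasing a) _ _ (in-block k∈) (in-block l∈) lt) (proj₂ l∈)
      where
      in-block : ∀ {k} → InRange (length (positions w a)) k → InRange (length (block a)) k
      in-block (1≤k , k≤) = 1≤k , subst (_ ≤_) (length-positions a) k≤

    toPerm-admissible : Admissible η (toPerm w)
    toPerm-admissible {i} {j} i∈ j∈ i<j same =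
      subst₂ _<_ (sym (Segment.at-F (locate i∈))) (sym (Segment.at-F (locate j∈)))
        (same-block-increasing (trans (sym (blk≡label i∈)) (trans same (blk≡label j∈)))
          (Segment.offset∈ (locate i∈)) (Segment.offset∈ (locate j∈))
          (subst₂ _<_ (sym (at-block i∈)) (sym (at-block j∈)) i<j))

    toWord∘toPerm : toWord η (toPerm w) ≡ w
    toWord∘toPerm = trans (List.map-cong-local (tabulate letter≡)) map-at-w
      where
      letter≡ : ∀ {j} → j ∈ R → blk η (pos (toPerm w) j) ≡ at w j
      letter≡ {j} j∈ with pos-spec (toPerm w) (∈-resp-↭ (↭-sym toPerm↭) j∈)
      ... | (1≤p , p≤) , at-p = trans (blk≡label p∈) (sym (proj₂ (∈-positions⁻ {w} j∈positions)))
        where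
        p∈ : pos (toPerm w) j ∈ R
        p∈ = ∈-range⁺ (1≤p , subst (pos (toPerm w) j ≤_) length-toPerm p≤)
        open Segment (locate p∈)
        j∈positions : j ∈ positions w label
        j∈positions = subst (_∈ positions w label) (trans (sym at-F) at-p) (at-∈ (positions w label) offset offset∈)

    toPerm∈Sup : toPerm w ∈ Sup η
    toPerm∈Sup = ∈-Sup⁺ η toPerm↭ toPerm-admissible

  toPerm∘toWord : ∀ {σ} → σ ∈ Sup η → toPerm (toWord η σ) ≡ σ
  toPerm∘toWord {σ} σ∈ = sym (begin
    σ                                                ≡⟨ map-at-range σ ⟨
    map (at σ) (range (length σ))                    ≡⟨ cong (λ m → map (at σ) (range m)) length-σ ⟩
    map (at σ) R                                     ≡⟨ cong (map (at σ)) concat-blocks ⟨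
    map (at σ) (concatMap block Rr)                  ≡⟨ List.map-concatMap (at σ) block Rr ⟩
    concatMap (map (at σ) ∘ block) Rr                ≡⟨ cong concat (List.map-cong σ[block]≡positions Rr) ⟩
    toPerm w                                         ∎)
    where
    open ≡-Reasoning
    admissible = proj₂ (∈-Sup⁻ η σ∈)
    open OfPermutation η σ (proj₁ (∈-Sup⁻ η σ∈)) admissible
      using (w; length-σ; at-∈R; pos-∈; at-pos; pos-at-σ; at-w)
    σ[block]≡positions : ∀ a → map (at σ) (block a) ≡ positions w a
    σ[block]≡positions a = increasing-≡ _ _
      (increasing-map (at σ) (block a) (block-increasing a)
        λ x∈ y∈ lt → admissible (proj₁ (∈-block⁻ x∈)) (proj₁ (∈-block⁻ y∈)) lt (trans (proj₂ (∈-block⁻ x∈)) (sym (proj₂ (∈-block⁻ y∈)))))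
      (positions-increasing w a) (⊆ , ⊇)
      where
      ⊆ : ∀ {y} → y ∈ map (at σ) (block a) → y ∈ positions w a
      ⊆ y∈ with ∈-map⁻ (at σ) y∈
      ... | x , x∈ , refl = ∈-positions⁺ {w} (at-∈R x∈R)
                              (trans (at-w (at-∈R x∈R)) (trans (cong (blk η) (pos-at-σ x∈R)) (proj₂ (∈-block⁻ x∈))))
        where x∈R = proj₁ (∈-block⁻ x∈)
      ⊇ : ∀ {y} → y ∈ positions w a → y ∈ map (at σ) (block a)
      ⊇ {y} y∈ with ∈-positions⁻ {w} y∈
      ... | y∈R , at-w≡a = subst (_∈ map (at σ) (block a)) (at-pos y∈R)
                              (∈-map⁺ (at σ) (∈-block⁺ (pos-∈ y∈R) (trans (sym (at-w y∈R)) at-w≡a)))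

  toWord-↭ : map (toWord η) (Sup η) ↭ Sη η
  toWord-↭ = unique-↭ (unique-map (toWord η) Sup-unique toWord-injective) Sη-unique (⊆ , ⊇)
    where
    Sup-unique : Unique (Sup η)
    Sup-unique = Unique.filter⁺ _ (Unique.filter⁺ _ (words-unique n n))
    Sη-unique : Unique (Sη η)
    Sη-unique = Unique.filter⁺ _ (words-unique n r)
    toWord-injective : ∀ {σ τ} → σ ∈ Sup η → τ ∈ Sup η → toWord η σ ≡ toWord η τ → σ ≡ τ
    toWord-injective σ∈ τ∈ eq = trans (sym (toPerm∘toWord σ∈)) (trans (cong toPerm eq) (toPerm∘toWord τ∈))
    ⊆ : ∀ {w} → w ∈ map (toWord η) (Sup η) → w ∈ Sη η
    ⊆ w∈ with ∈-map⁻ (toWord η) w∈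
    ... | σ , σ∈ , refl = OfPermutation.w∈Sη η σ (proj₁ (∈-Sup⁻ η σ∈)) (proj₂ (∈-Sup⁻ η σ∈))
    ⊇ : ∀ {w} → w ∈ Sη η → w ∈ map (toWord η) (Sup η)
    ⊇ {w} w∈ with ∈-Sη⁻ η w∈
    ... | length≡ , in-range , w↭ = subst (_∈ map (toWord η) (Sup η)) toWord∘toPerm (∈-map⁺ (toWord η) toPerm∈Sup)
      where open OfWord w length≡ in-range w↭

-- Empty parts of η are harmless (they contribute empty blocks).
theorem4p1 : (η : List ℕ) → All (0 <_) η →
    map (λ σ → (den η σ , iexc η σ)) (Sup η) ↭ map (λ w → (+ denH η w , exc η w)) (Sη η)
theorem4p1 η _ = begin
  map (λ σ → (den η σ , iexc η σ)) (Sup η)   ≡⟨ List.map-cong-local (tabulate statistics) ⟩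
  map (stats ∘ toWord η) (Sup η)              ≡⟨ List.map-∘ (Sup η) ⟩
  map stats (map (toWord η) (Sup η))          ↭⟨ map⁺ stats (Inverse.toWord-↭ η) ⟩
  map stats (Sη η)                            ∎
  where
  open PermutationReasoning
  stats : List ℕ → ℤ × ℕ
  stats w = (+ denH η w , exc η w)
  statistics : ∀ {σ} → σ ∈ Sup η → (den η σ , iexc η σ) ≡ stats (toWord η σ)
  statistics σ∈ = OfPermutation.statistics η _ (proj₁ (∈-Sup⁻ η σ∈)) (proj₂ (∈-Sup⁻ η σ∈))
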